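{- Let $\mathbb T$ be the Terwilliger $\mathbb F$-algebra of the factorial association scheme $\{R_0,\dots,R_d\}$ with respect to a point $\mathbf x$. Then $\mathbb T$ is semisimple if and only if the subalgebra $E_d^*\mathbb TE_d^*$ is semisimple. Moreover, $\mathbb T$ is semisimple if and only if its center $\mathrm Z(\mathbb T)$ is semisimple.
   Context: Let $n\ge1$ and let $\mathbb U_1,\dots,\mathbb U_n$ be finite sets with $|\mathbb U_a|=u_a\ge2$. Put $\mathbb X=\prod_a\mathbb U_a$, $d=2^n-1$. For $g\in[0,d]$ with binary expansion $g=\sum_{a=1}^n g_{(a)}2^{a-1}$ let $\mathbb P(g)=\{a:g_{(a)}=1\}$ and $R_g=\{(\mathbf u,\mathbf v)\in\mathbb X^2:\mathbf u_a\ne\mathbf v_a\iff a\in\mathbb P(g)\}$; $\{R_0,\dots,R_d\}$ is the factorial association scheme (so $R_d$ is the relation "differ in every coordinate"). For a field $\mathbb F$, $A_g$ is the $\{0,1\}$ adjacency matrix of $R_g$ in $M_{\mathbb X}(\mathbb F)$; fixing $\mathbf x\in\mathbb X$, $E_g^*$ is the diagonal $\{0,1\}$-matrix with $E_g^*(\mathbf u,\mathbf u)=1$ iff $(\mathbf x,\mathbf u)\in R_g$; $\mathbb T$ is the subalgebra of $M_{\mathbb X}(\mathbb F)$ generated by all $A_g,E_g^*$. $E_d^*\mathbb TE_d^*=\{E_d^*ME_d^*:M\in\mathbb T\}$ is an algebra with identity $E_d^*$. -}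

module Defs where

open import Level using (Level; _⊔_) renaming (suc to lsuc)
open import Algebra.Bundles using (CommutativeRing)
open import Data.Nat using (ℕ; zero; suc)
open import Data.Fin using (Fin; zero; suc)
open import Data.Fin.Properties using (all?) renaming (_≟_ to _≟ᶠ_)
open import Data.Fin.Subset using (Subset; _∈_) renaming (⊤ to full)
open import Data.Fin.Subset.Properties using (_∈?_)
open import Data.List using (List; []; _∷_; foldr; concatMap; map; allFin)
open import Data.Bool using (Bool; true; false; if_then_else_; _∧_)
open import Data.Product using (Σ; ∃; _×_; _,_)
open import Relation.Nullary using (¬_; Dec; yes; no)
open import Relation.Nullary.Decidable using (⌊_⌋)
open import Relation.Binary.PropositionalEquality using (_≡_)
open import Function.Bundles using (_⇔_; mk⇔; Equivalence)
open import Function using (_∘_)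

record Field (c ℓ : Level) : Set (lsuc (c ⊔ ℓ)) where
  field
    commutativeRing : CommutativeRing c ℓ
  open CommutativeRing commutativeRing public
  field
    0≉1 : ¬ (0# ≈ 1#)
    inverse : ∀ x → ¬ (x ≈ 0#) → ∃ λ y → (x * y) ≈ 1#

Pt : (n : ℕ) → (Fin n → ℕ) → Set
Pt n u = (a : Fin n) → Fin (u a)

consPt : ∀ {n} {u : Fin (suc n) → ℕ} → Fin (u zero) → Pt n (u ∘ suc) → Pt (suc n) u
consPt i p zero    = i
consPt i p (suc a) = p a

allPts : (n : ℕ) (u : Fin n → ℕ) → List (Pt n u)
allPts zero    u = (λ ()) ∷ []
allPts (suc n) u =
  concatMap (λ i → map (consPt i) (allPts n (u ∘ suc))) (allFin (u zero))

-- Relations of the factorial scheme, indexed by P = ℙ(g) ⊆ {1..n}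
-- (g ↦ ℙ(g) is a bijection [0,d] → subsets; d ↦ full subset).
R : ∀ {n u} → Subset n → Pt n u → Pt n u → Set
R P v w = ∀ a → ((¬ (v a ≡ w a)) ⇔ (a ∈ P))

_⇔?_ : ∀ {A B : Set} → Dec A → Dec B → Dec (A ⇔ B)
yes a ⇔? yes b = yes (mk⇔ (λ _ → b) (λ _ → a))
yes a ⇔? no ¬b = no (λ e → ¬b (Equivalence.to e a))
no ¬a ⇔? yes b = no (λ e → ¬a (Equivalence.from e b))
no ¬a ⇔? no ¬b = yes (mk⇔ (λ x → Data.Empty.⊥-elim (¬a x)) (λ y → Data.Empty.⊥-elim (¬b y)))
  where import Data.Empty

¬? : ∀ {A : Set} → Dec A → Dec (¬ A)
¬? (yes a) = no (λ f → f a)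
¬? (no ¬a) = yes ¬a

R? : ∀ {n u} (P : Subset n) (v w : Pt n u) → Dec (R P v w)
R? P v w = all? (λ a → ¬? (v a ≟ᶠ w a) ⇔? (a ∈? P))

samePt? : ∀ {n u} (v w : Pt n u) → Dec (∀ a → v a ≡ w a)
samePt? v w = all? (λ a → v a ≟ᶠ w a)

module Terwilliger {c ℓ : Level} (𝔽 : Field c ℓ) (n : ℕ) (u : Fin n → ℕ) where
  open Field 𝔽

  Mat : Set c
  Mat = Pt n u → Pt n u → Carrier

  _≈ₘ_ : Mat → Mat → Set ℓ
  M ≈ₘ N = ∀ v w → M v w ≈ N v w

  Σₓ : (Pt n u → Carrier) → Carrier
  Σₓ f = foldr (λ p acc → f p + acc) 0# (allPts n u)

  _⊕_ : Mat → Mat → Mat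
  (M ⊕ N) v w = M v w + N v w

  _·_ : Carrier → Mat → Mat
  (k · M) v w = k * M v w

  _⊗_ : Mat → Mat → Mat
  (M ⊗ N) v w = Σₓ (λ z → M v z * N z w)

  _⊖_ : Mat → Mat → Mat
  M ⊖ N = M ⊕ ((- 1#) · N)

  𝟘 : Mat
  𝟘 v w = 0#

  𝟙 : Mat
  𝟙 v w = if ⌊ samePt? v w ⌋ then 1# else 0#

  A : Subset n → Mat
  A P v w = if ⌊ R? P v w ⌋ then 1# else 0#

  Estar : Pt n u → Subset n → Mat
  Estar x P v w = if ⌊ samePt? v w ⌋ ∧ ⌊ R? P x v ⌋ then 1# else 0#

  data InT (x : Pt n u) : Mat → Set (c ⊔ ℓ) where
    genA : ∀ P → InT x (A P)
    genE : ∀ P → InT x (Estar x P)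
    unit : InT x 𝟙
    add  : ∀ {M N} → InT x M → InT x N → InT x (M ⊕ N)
    smul : ∀ k {M} → InT x M → InT x (k · M)
    mul  : ∀ {M N} → InT x M → InT x N → InT x (M ⊗ N)
    resp : ∀ {M N} → M ≈ₘ N → InT x M → InT x N

  InEdTEd : Pt n u → Mat → Set (c ⊔ ℓ)
  InEdTEd x N = Σ Mat λ M → InT x M × (N ≈ₘ ((Estar x full ⊗ M) ⊗ Estar x full))

  InZ : Pt n u → Mat → Set (c ⊔ ℓ)
  InZ x M = InT x M × (∀ N → InT x N → (M ⊗ N) ≈ₘ (N ⊗ M))

  -- A finite-dimensional F-algebra S ⊆ M_X(F) (given by its membership
  -- predicate) with identity e is semisimple iff its Jacobson radical
  -- is zero, where  J(S) = { a ∈ S : ∀ b ∈ S, e - b a has a left inverse in S }.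
  Semisimple : (Mat → Set (c ⊔ ℓ)) → Mat → Set (c ⊔ ℓ)
  Semisimple S e =
    ∀ a → S a →
      (∀ b → S b → Σ Mat λ c' → S c' × ((c' ⊗ (e ⊖ (b ⊗ a))) ≈ₘ e)) →
      a ≈ₘ 𝟘

-- Write e = E*_d. Two facts about a corner eTe of a ring T reduce the theorem to the
-- combinatorics of the scheme. By Jacobson's lemma (f - yx has a left inverse iff f - xy has),
-- applied inside eTe, J(eTe) ⊆ J(T) and e J(T) e ⊆ J(eTe); so T semisimple implies eTe
-- semisimple, and conversely as soon as e I e ≠ 0 for every nonzero ideal I of T. Under the same
-- condition W ↦ We is an injective ring map Z(T) → eTe, hence an isomorphism once every eMe has
-- the form We with W central.
-- For the factorial scheme everything factors over the coordinates. T is spanned by tensor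
-- products of one-coordinate matrices L invariant under the stabiliser of x_a; each such L has a
-- lift to the centre of the one-coordinate algebra that agrees with L away from x_a, and the
-- tensor product W of the lifts lies in Z(T) with We = eMe. Finally, since |U_a| ≥ 2, every entry
-- M(t,s) is an entry of e(YMZ)e for suitable Y, Z ∈ T, taken at points that differ from x in
-- every coordinate; so e I e ≠ 0 whenever I ≠ 0.

module Submission where

open import Defs
open import Level using (Level; _⊔_)
open import Algebra.Bundles using (Ring; CommutativeRing)
open import Data.Nat using (ℕ; zero; suc; _≤_; s≤s)
open import Data.Fin using (Fin; zero; suc)
open import Data.Fin.Patterns using (0F; 1F; 2F)
open import Data.Fin.Properties using (all?; any?; suc-injective) renaming (_≟_ to _≟ᶠ_)
import Data.Fin.Permutation as Perm
import Data.Fin.Permutation.Components as PC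
open import Data.Fin.Subset using (Subset; _∈_; inside; outside) renaming (⊤ to full)
open import Data.Fin.Subset.Properties using (_∈?_)
open import Data.Vec using (lookup; tabulate) renaming (_∷_ to _∷ᵛ_)
open import Data.Vec.Properties using (lookup∘tabulate; lookup-replicate)
import Data.List as List
open import Data.List using (List; []; _∷_; foldr; map; concatMap; _++_; allFin; cartesianProductWith)
open import Data.List.Relation.Unary.All using (All; []; _∷_)
open import Data.List.Relation.Unary.All.Properties using (++⁺; map⁺)
open import Data.Bool using (Bool; true; false; if_then_else_; _∧_; not)
open import Data.Product using (_×_; _,_; proj₁; proj₂; Σ; ∃)
open import Data.Empty using (⊥-elim)
open import Function using (_∘_; id)
open import Function.Bundles using (_⇔_; mk⇔)
open import Function.Properties.Equivalence using () renaming (trans to ⇔-trans; sym to ⇔-sym)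
open import Relation.Nullary using (¬_; Dec; yes; no)
open import Relation.Nullary.Decidable using (⌊_⌋; _×-dec_; dec-true; dec-false; ⌊⌋-map′)
open import Relation.Binary.Bundles using (Setoid)
import Relation.Binary.Reasoning.Setoid as SetoidReasoning
open import Relation.Binary.PropositionalEquality as ≡ using (_≡_; _≢_)

⌊⌋-≡ : ∀ {X Y : Set} (d : Dec X) (d′ : Dec Y) → (X → Y) → (Y → X) → ⌊ d ⌋ ≡ ⌊ d′ ⌋
⌊⌋-≡ (yes x) (yes y) f g = ≡.refl
⌊⌋-≡ (yes x) (no ¬y) f g = ⊥-elim (¬y (f x))
⌊⌋-≡ (no ¬x) (yes y) f g = ⊥-elim (¬x (g y))
⌊⌋-≡ (no ¬x) (no ¬y) f g = ≡.refl

⌊×-dec⌋ : ∀ {X Y : Set} (d : Dec X) (d′ : Dec Y) → ⌊ d ×-dec d′ ⌋ ≡ ⌊ d ⌋ ∧ ⌊ d′ ⌋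
⌊×-dec⌋ (yes _) (yes _) = ≡.refl
⌊×-dec⌋ (yes _) (no _)  = ≡.refl
⌊×-dec⌋ (no _)  _       = ≡.refl

⌊¬?⇔?⌋ : ∀ {X Y : Set} (d : Dec X) (e : Dec Y) →
         ⌊ ¬? d ⇔? e ⌋ ≡ (if ⌊ e ⌋ then not ⌊ d ⌋ else ⌊ d ⌋)
⌊¬?⇔?⌋ (yes _) (yes _) = ≡.refl
⌊¬?⇔?⌋ (yes _) (no _)  = ≡.refl
⌊¬?⇔?⌋ (no _)  (yes _) = ≡.refl
⌊¬?⇔?⌋ (no _)  (no _)  = ≡.refl

⌊∈?⌋ : ∀ {m} (a : Fin m) (P : Subset m) → ⌊ a ∈? P ⌋ ≡ lookup P a
⌊∈?⌋ zero    (inside ∷ᵛ P)  = ≡.refl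
⌊∈?⌋ zero    (outside ∷ᵛ P) = ≡.refl
⌊∈?⌋ (suc a) (_ ∷ᵛ P)       = ≡.trans (⌊⌋-map′ _ _ (a ∈? P)) (⌊∈?⌋ a P)

⌊∈?full⌋ : ∀ {m} (a : Fin m) → ⌊ a ∈? full ⌋ ≡ true
⌊∈?full⌋ a = ≡.trans (⌊∈?⌋ a full) (lookup-replicate a inside)

⌊∈?tabulate⌋ : ∀ {m} (f : Fin m → Bool) a → ⌊ a ∈? tabulate f ⌋ ≡ f a
⌊∈?tabulate⌋ f a = ≡.trans (⌊∈?⌋ a (tabulate f)) (lookup∘tabulate f a)

awayFrom : ∀ {m} → 2 ≤ m → (ξ : Fin m) → Σ (Fin m) (ξ ≢_)
awayFrom (s≤s (s≤s _)) zero    = suc zero , λ ()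
awayFrom (s≤s (s≤s _)) (suc ξ) = zero , λ ()

module Radical {a ℓ} (R : Ring a ℓ) where
  open Ring R
  open import Algebra.Properties.Ring R
  open import Relation.Binary.Reasoning.Setoid setoid

  LeftInvertibleIn : ∀ {s} → (Carrier → Set s) → Carrier → Carrier → Set (a ⊔ ℓ ⊔ s)
  LeftInvertibleIn S f z = Σ Carrier λ y → S y × y * z ≈ f

  IsSemisimple : ∀ {s} → (Carrier → Set s) → Carrier → Set (a ⊔ ℓ ⊔ s)
  IsSemisimple S f = ∀ x → S x → (∀ b → S b → LeftInvertibleIn S f (f - b * x)) → x ≈ 0#

  x-y+y≈x : ∀ x y → (x - y) + y ≈ x
  x-y+y≈x x y = begin
    (x - y) + y   ≈⟨ +-assoc x (- y) y ⟩
    x + (- y + y) ≈⟨ +-congˡ (-‿inverseˡ y) ⟩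
    x + 0#        ≈⟨ +-identityʳ x ⟩
    x             ∎

  x-0≈x : ∀ x → x - 0# ≈ x
  x-0≈x x = trans (+-congˡ -0#≈0#) (+-identityʳ x)

  -- Jacobson's lemma, inside the corner fRf.
  left-inverse-swap : ∀ {f x y w} → f * f ≈ f → f * x ≈ x → f * y ≈ y → y * f ≈ y →
                      w * (f - y * x) ≈ f → (f + (x * w) * y) * (f - x * y) ≈ f
  left-inverse-swap {f} {x} {y} {w} ff fx fy yf w-inv = begin
      (f + (x * w) * y) * (f - x * y)
    ≈⟨ distribʳ (f - x * y) f ((x * w) * y) ⟩
      f * (f - x * y) + ((x * w) * y) * (f - x * y)
    ≈⟨ +-cong f[f-xy]≈f-xy xwy[f-xy]≈xy ⟩
      (f - x * y) + x * y
    ≈⟨ x-y+y≈x f (x * y) ⟩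
      f ∎
    where
    f[f-xy]≈f-xy : f * (f - x * y) ≈ f - x * y
    f[f-xy]≈f-xy = begin
      f * (f - x * y)     ≈⟨ x[y-z]≈xy-xz f f (x * y) ⟩
      f * f - f * (x * y) ≈⟨ +-cong ff (-‿cong (sym (*-assoc f x y))) ⟩
      f - (f * x) * y     ≈⟨ +-congˡ (-‿cong (*-congʳ fx)) ⟩
      f - x * y           ∎
    y[f-xy]≈[f-yx]y : y * (f - x * y) ≈ (f - y * x) * y
    y[f-xy]≈[f-yx]y = begin
      y * (f - x * y)     ≈⟨ x[y-z]≈xy-xz y f (x * y) ⟩
      y * f - y * (x * y) ≈⟨ +-cong (trans yf (sym fy)) (-‿cong (sym (*-assoc y x y))) ⟩
      f * y - (y * x) * y ≈⟨ [y-z]x≈yx-zx y f (y * x) ⟨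
      (f - y * x) * y     ∎
    xwy[f-xy]≈xy : ((x * w) * y) * (f - x * y) ≈ x * y
    xwy[f-xy]≈xy = begin
      ((x * w) * y) * (f - x * y) ≈⟨ *-assoc (x * w) y _ ⟩
      (x * w) * (y * (f - x * y)) ≈⟨ *-congˡ y[f-xy]≈[f-yx]y ⟩
      (x * w) * ((f - y * x) * y) ≈⟨ *-assoc x w _ ⟩
      x * (w * ((f - y * x) * y)) ≈⟨ *-congˡ (*-assoc w _ y) ⟨
      x * ((w * (f - y * x)) * y) ≈⟨ *-congˡ (*-congʳ w-inv) ⟩
      x * (f * y)                 ≈⟨ *-congˡ fy ⟩
      x * y                       ∎

  left-inverse-swap₁ : ∀ {x y w} → w * (1# - y * x) ≈ 1# → (1# + (x * w) * y) * (1# - x * y) ≈ 1#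
  left-inverse-swap₁ {x} {y} =
    left-inverse-swap (*-identityˡ 1#) (*-identityˡ x) (*-identityˡ y) (*-identityʳ y)

  -- A left inverse d of e - q in the corner eRe, completed by 1 - e.
  left-inverse-extend : ∀ {e q d} → e * q ≈ q → d * e ≈ d → d * (e - q) ≈ e →
                        ((1# - e) + d) * (1# - q) ≈ 1#
  left-inverse-extend {e} {q} {d} eq de d-inv = begin
      ((1# - e) + d) * (1# - q)
    ≈⟨ distribʳ (1# - q) (1# - e) d ⟩
      (1# - e) * (1# - q) + d * (1# - q)
    ≈⟨ +-cong [1-e][1-q]≈1-e d[1-q]≈e ⟩
      (1# - e) + e
    ≈⟨ x-y+y≈x 1# e ⟩
      1# ∎
    where
    [1-e]q≈0 : (1# - e) * q ≈ 0#
    [1-e]q≈0 = begin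
      (1# - e) * q   ≈⟨ [y-z]x≈yx-zx q 1# e ⟩
      1# * q - e * q ≈⟨ x≈y⇒x∙y⁻¹≈ε (trans (*-identityˡ q) (sym eq)) ⟩
      0#             ∎
    [1-e][1-q]≈1-e : (1# - e) * (1# - q) ≈ 1# - e
    [1-e][1-q]≈1-e = begin
      (1# - e) * (1# - q)           ≈⟨ x[y-z]≈xy-xz (1# - e) 1# q ⟩
      (1# - e) * 1# - (1# - e) * q  ≈⟨ +-congˡ (-‿cong [1-e]q≈0) ⟩
      (1# - e) * 1# - 0#            ≈⟨ x-0≈x _ ⟩
      (1# - e) * 1#                 ≈⟨ *-identityʳ _ ⟩
      1# - e                        ∎
    d[1-q]≈e : d * (1# - q) ≈ e
    d[1-q]≈e = begin
      d * (1# - q)       ≈⟨ x[y-z]≈xy-xz d 1# q ⟩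
      d * 1# - d * q     ≈⟨ +-congʳ (trans (*-identityʳ d) (sym de)) ⟩
      d * e - d * q      ≈⟨ x[y-z]≈xy-xz d e q ⟨
      d * (e - q)        ≈⟨ d-inv ⟩
      e                  ∎

  module _ {s t} {S : Carrier → Set s} {S′ : Carrier → Set t} {f f′ : Carrier}
           (S-f : S f) (S-* : ∀ {u v} → S u → S v → S (u * v))
           (S-- : ∀ {u v} → S u → S v → S (u - v))
           (φ : Carrier → Carrier) (φ-cong : ∀ {u v} → u ≈ v → φ u ≈ φ v)
           (φ-f : φ f ≈ f′) (φ-- : ∀ u v → φ (u - v) ≈ φ u - φ v)
           (φ-* : ∀ {u v} → S u → S v → φ (u * v) ≈ φ u * φ v)
           (φ-into : ∀ {u} → S u → S′ (φ u))
           (φ-onto : ∀ {v} → S′ v → Σ Carrier λ u → S u × φ u ≈ v)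
           (φ-kernel : ∀ {u} → S u → φ u ≈ 0# → u ≈ 0#) where

    private
      φ-0 : φ 0# ≈ 0#
      φ-0 = begin
        φ 0#          ≈⟨ φ-cong (x≈y⇒x∙y⁻¹≈ε refl) ⟨
        φ (f - f)     ≈⟨ φ-- f f ⟩
        φ f - φ f     ≈⟨ x≈y⇒x∙y⁻¹≈ε refl ⟩
        0#            ∎

      φ-f-bx : ∀ {b x} → S b → S x → φ (f - b * x) ≈ f′ - φ b * φ x
      φ-f-bx {b} {x} Sb Sx = trans (φ-- f (b * x)) (+-cong φ-f (-‿cong (φ-* Sb Sx)))

    semisimple-transfer : IsSemisimple S f ⇔ IsSemisimple S′ f′
    semisimple-transfer = mk⇔ to from
      where
      to : IsSemisimple S f → IsSemisimple S′ f′
      to ss x′ S′x′ x′-qr with φ-onto S′x′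
      ... | x , Sx , φx≈x′ = begin
        x′    ≈⟨ φx≈x′ ⟨
        φ x   ≈⟨ φ-cong (ss x Sx x-qr) ⟩
        φ 0#  ≈⟨ φ-0 ⟩
        0#    ∎
        where
        x-qr : ∀ b → S b → LeftInvertibleIn S f (f - b * x)
        x-qr b Sb with x′-qr (φ b) (φ-into Sb)
        ... | y′ , S′y′ , y′-inv with φ-onto S′y′
        ... | y , Sy , φy≈y′ = y , Sy , x∙y⁻¹≈ε⇒x≈y _ f (φ-kernel (S-- Sy[f-bx] S-f) φ≈0)
          where
          Sy[f-bx] : S (y * (f - b * x))
          Sy[f-bx] = S-* Sy (S-- S-f (S-* Sb Sx))
          φ≈0 : φ (y * (f - b * x) - f) ≈ 0#
          φ≈0 = begin
            φ (y * (f - b * x) - f)       ≈⟨ φ-- _ f ⟩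
            φ (y * (f - b * x)) - φ f     ≈⟨ +-cong (φ-* Sy (S-- S-f (S-* Sb Sx))) (-‿cong φ-f) ⟩
            φ y * φ (f - b * x) - f′      ≈⟨ +-congʳ (*-cong φy≈y′ (φ-f-bx Sb Sx)) ⟩
            y′ * (f′ - φ b * φ x) - f′
              ≈⟨ +-congʳ (*-congˡ (+-congˡ (-‿cong (*-congˡ φx≈x′)))) ⟩
            y′ * (f′ - φ b * x′) - f′     ≈⟨ x≈y⇒x∙y⁻¹≈ε y′-inv ⟩
            0#                            ∎
      from : IsSemisimple S′ f′ → IsSemisimple S f
      from ss x Sx x-qr = φ-kernel Sx (ss (φ x) (φ-into Sx) φx-qr)
        where
        φx-qr : ∀ b′ → S′ b′ → LeftInvertibleIn S′ f′ (f′ - b′ * φ x)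
        φx-qr b′ S′b′ with φ-onto S′b′
        ... | b , Sb , φb≈b′ with x-qr b Sb
        ... | y , Sy , y-inv = φ y , φ-into Sy , (begin
          φ y * (f′ - b′ * φ x)    ≈⟨ *-congˡ (+-congˡ (-‿cong (*-congʳ φb≈b′))) ⟨
          φ y * (f′ - φ b * φ x)   ≈⟨ *-congˡ (φ-f-bx Sb Sx) ⟨
          φ y * φ (f - b * x)      ≈⟨ φ-* Sy (S-- S-f (S-* Sb Sx)) ⟨
          φ (y * (f - b * x))      ≈⟨ φ-cong y-inv ⟩
          φ f                      ≈⟨ φ-f ⟩
          f′                       ∎)

  module Corner {t} (T : Carrier → Set t)
           (T-cong : ∀ {x y} → x ≈ y → T x → T y) (T-1 : T 1#)
           (T-+ : ∀ {x y} → T x → T y → T (x + y)) (T-* : ∀ {x y} → T x → T y → T (x * y))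
           (T-‿ : ∀ {x} → T x → T (- x))
           {e : Carrier} (T-e : T e) (e-idem : e * e ≈ e) where

    T-- : ∀ {x y} → T x → T y → T (x - y)
    T-- Tx Ty = T-+ Tx (T-‿ Ty)

    InCorner : Carrier → Set (a ⊔ ℓ ⊔ t)
    InCorner x = Σ Carrier λ M → T M × x ≈ (e * M) * e

    InCentre : Carrier → Set (a ⊔ ℓ ⊔ t)
    InCentre x = T x × (∀ N → T N → x * N ≈ N * x)

    Quasiregular : Carrier → Set (a ⊔ ℓ ⊔ t)
    Quasiregular x = ∀ b → T b → LeftInvertibleIn T 1# (1# - b * x)

    corner-T : ∀ {x} → InCorner x → T x
    corner-T (M , TM , x≈eMe) = T-cong (sym x≈eMe) (T-* (T-* T-e TM) T-e)

    e[eMe]≈eMe : ∀ M → e * ((e * M) * e) ≈ (e * M) * e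
    e[eMe]≈eMe M = begin
      e * ((e * M) * e) ≈⟨ *-assoc e (e * M) e ⟨
      (e * (e * M)) * e ≈⟨ *-congʳ (*-assoc e e M) ⟨
      ((e * e) * M) * e ≈⟨ *-congʳ (*-congʳ e-idem) ⟩
      (e * M) * e       ∎

    [eMe]e≈eMe : ∀ M → ((e * M) * e) * e ≈ (e * M) * e
    [eMe]e≈eMe M = trans (*-assoc (e * M) e e) (*-congˡ e-idem)

    corner-eˡ : ∀ {x} → InCorner x → e * x ≈ x
    corner-eˡ (M , _ , x≈eMe) = trans (*-congˡ x≈eMe) (trans (e[eMe]≈eMe M) (sym x≈eMe))

    corner-eʳ : ∀ {x} → InCorner x → x * e ≈ x
    corner-eʳ (M , _ , x≈eMe) = trans (*-congʳ x≈eMe) (trans ([eMe]e≈eMe M) (sym x≈eMe))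

    corner-quasiregular⇒quasiregular : ∀ {x} → InCorner x →
      (∀ b → InCorner b → LeftInvertibleIn InCorner e (e - b * x)) → Quasiregular x
    -- For b ∈ T: invert e - x(ebe) in eTe, extend to an inverse of 1 - x(be), and swap back.
    corner-quasiregular⇒quasiregular {x} Ex x-qr b Tb =
      1# + ((b * e) * L) * x , T-+ T-1 (T-* (T-* (T-* Tb T-e) TL) Tx) ,
      trans (*-congˡ (+-congˡ (-‿cong (sym bex≈bx)))) (left-inverse-swap₁ L-inv)
      where
      Tx : T x
      Tx = corner-T Ex
      b′ : Carrier
      b′ = (e * b) * e
      Eb′ : InCorner b′
      Eb′ = b , Tb , refl
      c : Carrier
      c = proj₁ (x-qr b′ Eb′)
      Ec : InCorner c
      Ec = proj₁ (proj₂ (x-qr b′ Eb′))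
      d : Carrier
      d = e + (x * c) * b′
      d-inv : d * (e - x * b′) ≈ e
      d-inv = left-inverse-swap e-idem (corner-eˡ Ex) (corner-eˡ Eb′) (corner-eʳ Eb′)
                                (proj₂ (proj₂ (x-qr b′ Eb′)))
      de≈d : d * e ≈ d
      de≈d = begin
        (e + (x * c) * b′) * e        ≈⟨ distribʳ e e _ ⟩
        e * e + ((x * c) * b′) * e    ≈⟨ +-cong e-idem (*-assoc (x * c) b′ e) ⟩
        e + (x * c) * (b′ * e)        ≈⟨ +-congˡ (*-congˡ (corner-eʳ Eb′)) ⟩
        d                             ∎
      xb′≈xbe : x * b′ ≈ x * (b * e)
      xb′≈xbe = begin
        x * ((e * b) * e) ≈⟨ *-congˡ (*-assoc e b e) ⟩
        x * (e * (b * e)) ≈⟨ *-assoc x e (b * e) ⟨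
        (x * e) * (b * e) ≈⟨ *-congʳ (corner-eʳ Ex) ⟩
        x * (b * e)       ∎
      L : Carrier
      L = (1# - e) + d
      TL : T L
      TL = T-+ (T-- T-1 T-e) (T-+ T-e (T-* (T-* Tx (corner-T Ec)) (corner-T Eb′)))
      L-inv : L * (1# - x * (b * e)) ≈ 1#
      L-inv = trans (*-congˡ (+-congˡ (-‿cong (sym xb′≈xbe))))
        (left-inverse-extend (trans (sym (*-assoc e x b′)) (*-congʳ (corner-eˡ Ex))) de≈d d-inv)
      bex≈bx : (b * e) * x ≈ b * x
      bex≈bx = trans (*-assoc b e x) (*-congˡ (corner-eˡ Ex))

    semisimple⇒corner-semisimple : IsSemisimple T 1# → IsSemisimple InCorner e
    semisimple⇒corner-semisimple ss x Ex x-qr =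
      ss x (corner-T Ex) (corner-quasiregular⇒quasiregular Ex x-qr)

    quasiregular-*ˡ : ∀ {r x} → T r → Quasiregular x → Quasiregular (r * x)
    quasiregular-*ˡ {r} {x} Tr x-qr b Tb with x-qr (b * r) (T-* Tb Tr)
    ... | y , Ty , y-inv = y , Ty , trans (*-congˡ (+-congˡ (-‿cong (sym (*-assoc b r x))))) y-inv

    quasiregular-*ʳ : ∀ {r x} → T r → T x → Quasiregular x → Quasiregular (x * r)
    quasiregular-*ʳ {r} {x} Tr Tx x-qr b Tb with x-qr (r * b) (T-* Tr Tb)
    ... | y , Ty , y-inv =
      1# + (b * z) * (x * r) , T-+ T-1 (T-* (T-* Tb Tz) (T-* Tx Tr)) , left-inverse-swap₁ z-inv
      where
      z : Carrier
      z = 1# + (x * y) * (r * b)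
      Tz : T z
      Tz = T-+ T-1 (T-* (T-* Tx Ty) (T-* Tr Tb))
      z-inv : z * (1# - (x * r) * b) ≈ 1#
      z-inv = trans (*-congˡ (+-congˡ (-‿cong (*-assoc x r b)))) (left-inverse-swap₁ y-inv)

    quasiregular⇒corner-quasiregular : ∀ {j} → T j → Quasiregular j →
      ∀ b → InCorner b → LeftInvertibleIn InCorner e (e - b * ((e * j) * e))
    quasiregular⇒corner-quasiregular {j} Tj j-qr b Eb with
      quasiregular-*ʳ T-e (T-* T-e Tj) (quasiregular-*ˡ T-e j-qr) b (corner-T Eb)
    ... | y , Ty , y-inv = (e * y) * e , (y , Ty , refl) , (begin
      ((e * y) * e) * (e - q) ≈⟨ *-assoc (e * y) e _ ⟩
      (e * y) * (e * (e - q)) ≈⟨ *-congˡ e[e-q]≈e-q ⟩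
      (e * y) * (e - q)       ≈⟨ *-congˡ [1-q]e≈e-q ⟨
      (e * y) * ((1# - q) * e) ≈⟨ *-assoc (e * y) (1# - q) e ⟨
      ((e * y) * (1# - q)) * e ≈⟨ *-congʳ (*-assoc e y (1# - q)) ⟩
      (e * (y * (1# - q))) * e ≈⟨ *-congʳ (*-congˡ y-inv) ⟩
      (e * 1#) * e            ≈⟨ *-congʳ (*-identityʳ e) ⟩
      e * e                   ≈⟨ e-idem ⟩
      e                       ∎)
      where
      q : Carrier
      q = b * ((e * j) * e)
      [1-q]e≈e-q : (1# - q) * e ≈ e - q
      [1-q]e≈e-q = trans ([y-z]x≈yx-zx e 1# q)
        (+-cong (*-identityˡ e) (-‿cong (trans (*-assoc b _ e) (*-congˡ ([eMe]e≈eMe j)))))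
      e[e-q]≈e-q : e * (e - q) ≈ e - q
      e[e-q]≈e-q = trans (x[y-z]≈xy-xz e e q)
        (+-cong e-idem (-‿cong (trans (sym (*-assoc e b _)) (*-congʳ (corner-eˡ Eb)))))

    -- e I e ≠ 0 for every nonzero two-sided ideal I of T.
    Faithful : Set (a ⊔ ℓ ⊔ t)
    Faithful = ∀ x → (∀ Y Z → T Y → T Z → (e * ((Y * x) * Z)) * e ≈ 0#) → x ≈ 0#

    corner-semisimple⇒semisimple : Faithful → IsSemisimple InCorner e → IsSemisimple T 1#
    corner-semisimple⇒semisimple faithful ss x Tx x-qr = faithful x λ Y Z TY TZ →
      let TYx = T-* TY Tx in
      ss _ (_ , T-* TYx TZ , refl)
        (quasiregular⇒corner-quasiregular (T-* TYx TZ)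
          (quasiregular-*ʳ TZ TYx (quasiregular-*ˡ TY x-qr)))

    centre-1 : InCentre 1#
    centre-1 = T-1 , λ N _ → trans (*-identityˡ N) (sym (*-identityʳ N))

    centre-* : ∀ {x y} → InCentre x → InCentre y → InCentre (x * y)
    centre-* {x} {y} (Tx , x-comm) (Ty , y-comm) = T-* Tx Ty , λ N TN → begin
      (x * y) * N ≈⟨ *-assoc x y N ⟩
      x * (y * N) ≈⟨ *-congˡ (y-comm N TN) ⟩
      x * (N * y) ≈⟨ *-assoc x N y ⟨
      (x * N) * y ≈⟨ *-congʳ (x-comm N TN) ⟩
      (N * x) * y ≈⟨ *-assoc N x y ⟩
      N * (x * y) ∎

    centre-- : ∀ {x y} → InCentre x → InCentre y → InCentre (x - y)
    centre-- {x} {y} (Tx , x-comm) (Ty , y-comm) = T-- Tx Ty , λ N TN → begin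
      (x - y) * N       ≈⟨ [y-z]x≈yx-zx N x y ⟩
      x * N - y * N     ≈⟨ +-cong (x-comm N TN) (-‿cong (y-comm N TN)) ⟩
      N * x - N * y     ≈⟨ x[y-z]≈xy-xz N x y ⟨
      N * (x - y)       ∎

    centre-[ue]e : ∀ {u} → InCentre u → (u * e) * e ≈ u * e
    centre-[ue]e {u} _ = trans (*-assoc u e e) (*-congˡ e-idem)

    module _ (faithful : Faithful)
             (lift : ∀ M → T M → Σ Carrier λ W → InCentre W × W * e ≈ (e * M) * e) where

      centre-kernel : ∀ {u} → InCentre u → u * e ≈ 0# → u ≈ 0#
      centre-kernel {u} (_ , u-comm) ue≈0 = faithful u λ Y Z _ TZ → begin
        (e * ((Y * u) * Z)) * e ≈⟨ *-congʳ (*-congˡ (*-assoc Y u Z)) ⟩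
        (e * (Y * (u * Z))) * e ≈⟨ *-congʳ (*-congˡ (*-congˡ (u-comm Z TZ))) ⟩
        (e * (Y * (Z * u))) * e ≈⟨ *-congʳ (*-congˡ (*-assoc Y Z u)) ⟨
        (e * ((Y * Z) * u)) * e ≈⟨ *-congʳ (*-assoc e (Y * Z) u) ⟨
        ((e * (Y * Z)) * u) * e ≈⟨ *-assoc (e * (Y * Z)) u e ⟩
        (e * (Y * Z)) * (u * e) ≈⟨ *-congˡ ue≈0 ⟩
        (e * (Y * Z)) * 0#      ≈⟨ zeroʳ _ ⟩
        0#                      ∎

      -- Z(T) → eTe, W ↦ We is an isomorphism of rings.
      centre-semisimple⇔corner-semisimple : IsSemisimple InCentre 1# ⇔ IsSemisimple InCorner e
      centre-semisimple⇔corner-semisimple =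
        semisimple-transfer centre-1 centre-* centre-- (_* e) *-congʳ (*-identityˡ e)
          (λ u v → [y-z]x≈yx-zx e u v) φ-* into onto centre-kernel
        where
        φ-* : ∀ {u v} → InCentre u → InCentre v → (u * v) * e ≈ (u * e) * (v * e)
        φ-* {u} {v} _ (Tv , v-comm) = begin
          (u * v) * e       ≈⟨ *-assoc u v e ⟩
          u * (v * e)       ≈⟨ *-congˡ (centre-[ue]e (Tv , v-comm)) ⟨
          u * ((v * e) * e) ≈⟨ *-congˡ (*-congʳ (v-comm e T-e)) ⟩
          u * ((e * v) * e) ≈⟨ *-congˡ (*-assoc e v e) ⟩
          u * (e * (v * e)) ≈⟨ *-assoc u e (v * e) ⟨
          (u * e) * (v * e) ∎
        into : ∀ {u} → InCentre u → InCorner (u * e)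
        into {u} Zu@(Tu , u-comm) =
          u , Tu , sym (trans (*-congʳ (sym (u-comm e T-e))) (centre-[ue]e Zu))
        onto : ∀ {v} → InCorner v → Σ Carrier λ u → InCentre u × u * e ≈ v
        onto (M , TM , v≈eMe) with lift M TM
        ... | W , ZW , We≈eMe = W , ZW , trans We≈eMe (sym v≈eMe)

module Sums {c ℓ} (R : CommutativeRing c ℓ) where
  open CommutativeRing R hiding (zero)
  open import Algebra.Properties.Ring ring using (-0#≈0#; -‿+-comm)
  open import Algebra.Properties.Semiring.Sum semiring public
    using (sum; sum-syntax; sum-cong-≋; ∑-distrib-+; *-distribˡ-sum; *-distribʳ-sum; sum-permute)
  open import Relation.Binary.Reasoning.Setoid setoid

  sumL : ∀ {a} {A : Set a} → List A → (A → Carrier) → Carrier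
  sumL xs f = foldr (λ p acc → f p + acc) 0# xs

  sumL-cong : ∀ {a} {A : Set a} (xs : List A) {f g : A → Carrier} →
              (∀ p → f p ≈ g p) → sumL xs f ≈ sumL xs g
  sumL-cong []       f≈g = refl
  sumL-cong (p ∷ xs) f≈g = +-cong (f≈g p) (sumL-cong xs f≈g)

  sumL-zero : ∀ {a} {A : Set a} (xs : List A) {f : A → Carrier} → (∀ p → f p ≈ 0#) → sumL xs f ≈ 0#
  sumL-zero []       f≈0 = refl
  sumL-zero (p ∷ xs) f≈0 = trans (+-cong (f≈0 p) (sumL-zero xs f≈0)) (+-identityˡ 0#)

  sumL-distrib-+ : ∀ {a} {A : Set a} (xs : List A) (f g : A → Carrier) →
                   sumL xs (λ p → f p + g p) ≈ sumL xs f + sumL xs g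
  sumL-distrib-+ []       f g = sym (+-identityˡ 0#)
  sumL-distrib-+ (p ∷ xs) f g = begin
    (f p + g p) + sumL xs (λ q → f q + g q) ≈⟨ +-congˡ (sumL-distrib-+ xs f g) ⟩
    (f p + g p) + (sumL xs f + sumL xs g)   ≈⟨ +-assoc (f p) (g p) _ ⟩
    f p + (g p + (sumL xs f + sumL xs g))   ≈⟨ +-congˡ (+-assoc (g p) _ _) ⟨
    f p + ((g p + sumL xs f) + sumL xs g)   ≈⟨ +-congˡ (+-congʳ (+-comm (g p) _)) ⟩
    f p + ((sumL xs f + g p) + sumL xs g)   ≈⟨ +-congˡ (+-assoc _ (g p) _) ⟩
    f p + (sumL xs f + (g p + sumL xs g))   ≈⟨ +-assoc (f p) _ _ ⟨
    (f p + sumL xs f) + (g p + sumL xs g)   ∎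

  *-distribˡ-sumL : ∀ {a} {A : Set a} (xs : List A) k (f : A → Carrier) →
                    k * sumL xs f ≈ sumL xs (λ p → k * f p)
  *-distribˡ-sumL []       k f = zeroʳ k
  *-distribˡ-sumL (p ∷ xs) k f = trans (distribˡ k (f p) _) (+-congˡ (*-distribˡ-sumL xs k f))

  *-distribʳ-sumL : ∀ {a} {A : Set a} (xs : List A) k (f : A → Carrier) →
                    sumL xs f * k ≈ sumL xs (λ p → f p * k)
  *-distribʳ-sumL []       k f = zeroˡ k
  *-distribʳ-sumL (p ∷ xs) k f = trans (distribʳ k (f p) _) (+-congˡ (*-distribʳ-sumL xs k f))

  sumL-comm : ∀ {a b} {A : Set a} {B : Set b} (xs : List A) (ys : List B) (h : A → B → Carrier) →
              sumL xs (λ p → sumL ys (h p)) ≈ sumL ys (λ q → sumL xs (λ p → h p q))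
  sumL-comm []       ys h = sym (sumL-zero ys (λ _ → refl))
  sumL-comm (p ∷ xs) ys h = trans (+-congˡ (sumL-comm xs ys h)) (sym (sumL-distrib-+ ys (h p) _))

  sumL-++ : ∀ {a} {A : Set a} (xs ys : List A) (f : A → Carrier) → sumL (xs ++ ys) f ≈ sumL xs f + sumL ys f
  sumL-++ []       ys f = sym (+-identityˡ _)
  sumL-++ (p ∷ xs) ys f = trans (+-congˡ (sumL-++ xs ys f)) (sym (+-assoc _ _ _))

  sumL-map : ∀ {a b} {A : Set a} {B : Set b} (g : A → B) (xs : List A) (f : B → Carrier) →
             sumL (map g xs) f ≡ sumL xs (f ∘ g)
  sumL-map g []       f = ≡.refl
  sumL-map g (p ∷ xs) f = ≡.cong (f (g p) +_) (sumL-map g xs f)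

  sumL-concatMap : ∀ {a b} {A : Set a} {B : Set b} (g : A → List B) (xs : List A) (f : B → Carrier) →
                   sumL (concatMap g xs) f ≈ sumL xs (λ p → sumL (g p) f)
  sumL-concatMap g []       f = refl
  sumL-concatMap g (p ∷ xs) f = trans (sumL-++ (g p) (concatMap g xs) f) (+-congˡ (sumL-concatMap g xs f))

  sumL-tabulate : ∀ {a} {A : Set a} m (g : Fin m → A) (f : A → Carrier) →
                  sumL (List.tabulate g) f ≡ sum (f ∘ g)
  sumL-tabulate zero    g f = ≡.refl
  sumL-tabulate (suc m) g f = ≡.cong (f (g zero) +_) (sumL-tabulate m (g ∘ suc) f)

  sum-zero : ∀ {m} (h : Fin m → Carrier) → (∀ i → h i ≈ 0#) → sum h ≈ 0#
  sum-zero {zero}  h h≈0 = refl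
  sum-zero {suc m} h h≈0 = trans (+-cong (h≈0 zero) (sum-zero (h ∘ suc) (h≈0 ∘ suc))) (+-identityˡ 0#)

  sum-single : ∀ {m} (i : Fin m) (h : Fin m → Carrier) → (∀ j → j ≢ i → h j ≈ 0#) → sum h ≈ h i
  sum-single zero    h h≈0 = trans (+-congˡ (sum-zero (h ∘ suc) (λ j → h≈0 (suc j) λ ()))) (+-identityʳ _)
  sum-single (suc i) h h≈0 =
    trans (+-cong (h≈0 zero λ ()) (sum-single i (h ∘ suc) λ j j≢i → h≈0 (suc j) (j≢i ∘ suc-injective)))
          (+-identityˡ _)

  sum-neg : ∀ {m} (h : Fin m → Carrier) → sum (λ i → - h i) ≈ - sum h
  sum-neg {zero}  h = sym -0#≈0#
  sum-neg {suc m} h = trans (+-congˡ (sum-neg (h ∘ suc))) (-‿+-comm (h zero) _)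

  open import Algebra.Properties.CommutativeMonoid.Sum *-commutativeMonoid public
    using () renaming (sum to prod; sum-cong-≋ to prod-cong; ∑-distrib-+ to prod-distrib-*)

  ind : Bool → Carrier
  ind b = if b then 1# else 0#

  ind-yes : ∀ {X : Set} (d : Dec X) → X → ind ⌊ d ⌋ ≡ 1#
  ind-yes (yes _) _ = ≡.refl
  ind-yes (no ¬x) x = ⊥-elim (¬x x)

  ind-no : ∀ {X : Set} (d : Dec X) → ¬ X → ind ⌊ d ⌋ ≡ 0#
  ind-no (yes x) ¬x = ⊥-elim (¬x x)
  ind-no (no _)  _  = ≡.refl

  ind-∧ : ∀ b b′ → ind (b ∧ b′) ≈ ind b * ind b′
  ind-∧ true  true  = sym (*-identityˡ 1#)
  ind-∧ true  false = sym (zeroʳ 1#)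
  ind-∧ false b′    = sym (zeroˡ _)

  ind-∧³ : ∀ p q r → (ind p * ind q) * ind r ≈ ind (p ∧ q ∧ r)
  ind-∧³ p q r = begin
    (ind p * ind q) * ind r   ≈⟨ *-assoc (ind p) (ind q) (ind r) ⟩
    ind p * (ind q * ind r)   ≈⟨ *-congˡ (ind-∧ q r) ⟨
    ind p * ind (q ∧ r)       ≈⟨ ind-∧ p (q ∧ r) ⟨
    ind (p ∧ q ∧ r)           ∎

  ind-idem : ∀ b → ind b * ind b ≈ ind b
  ind-idem true  = *-identityˡ 1#
  ind-idem false = zeroˡ 0#

  ind-not : ∀ b → ind (not b) ≈ 1# - ind b
  ind-not true  = sym (-‿inverseʳ 1#)
  ind-not false = sym (trans (+-congˡ -0#≈0#) (+-identityʳ 1#))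

  ind-all? : ∀ {m} {P : Fin m → Set} (P? : ∀ a → Dec (P a)) →
             ind ⌊ all? P? ⌋ ≈ prod (λ a → ind ⌊ P? a ⌋)
  ind-all? {zero}  P? = reflexive (ind-yes (all? P?) λ ())
  ind-all? {suc m} {P} P? = begin
    ind ⌊ all? P? ⌋                               ≡⟨ ≡.cong ind (⌊⌋-≡ (all? P?) both uncons cons) ⟩
    ind ⌊ both ⌋                                  ≡⟨ ≡.cong ind (⌊×-dec⌋ (P? zero) (all? (P? ∘ suc))) ⟩
    ind (⌊ P? zero ⌋ ∧ ⌊ all? (P? ∘ suc) ⌋)       ≈⟨ ind-∧ _ _ ⟩
    ind ⌊ P? zero ⌋ * ind ⌊ all? (P? ∘ suc) ⌋     ≈⟨ *-congˡ (ind-all? (P? ∘ suc)) ⟩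
    prod (λ a → ind ⌊ P? a ⌋)                     ∎
    where
    both : Dec (P zero × (∀ a → P (suc a)))
    both = P? zero ×-dec all? (P? ∘ suc)
    uncons : (∀ a → P a) → P zero × (∀ a → P (suc a))
    uncons h = h zero , h ∘ suc
    cons : P zero × (∀ a → P (suc a)) → ∀ a → P a
    cons (p , ps) zero    = p
    cons (p , ps) (suc a) = ps a

  -- Points are functions, so their equality is pointwise.
  infix 4 _≐_
  _≐_ : ∀ {n u} → Pt n u → Pt n u → Set
  v ≐ w = ∀ a → v a ≡ w a

  sumPts : ∀ n (u : Fin n → ℕ) → (Pt n u → Carrier) → Carrier
  sumPts n u = sumL (allPts n u)

  sumPts-suc : ∀ n (u : Fin (suc n) → ℕ) (f : Pt (suc n) u → Carrier) →
               sumPts (suc n) u f ≈ ∑[ i < u zero ] sumPts n (u ∘ suc) (f ∘ consPt i)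
  sumPts-suc n u f = begin
    sumL (concatMap (λ i → map (consPt i) (allPts n (u ∘ suc))) (allFin (u zero))) f
      ≈⟨ sumL-concatMap _ (allFin (u zero)) f ⟩
    sumL (allFin (u zero)) (λ i → sumL (map (consPt i) (allPts n (u ∘ suc))) f)
      ≡⟨ sumL-tabulate (u zero) id _ ⟩
    ∑[ i < u zero ] sumL (map (consPt i) (allPts n (u ∘ suc))) f
      ≈⟨ sum-cong-≋ (λ i → reflexive (sumL-map (consPt i) (allPts n (u ∘ suc)) f)) ⟩
    ∑[ i < u zero ] sumPts n (u ∘ suc) (f ∘ consPt i) ∎

  sumPts-prod : ∀ n (u : Fin n → ℕ) (F : (a : Fin n) → Fin (u a) → Carrier) →
                sumPts n u (λ z → prod (λ a → F a (z a))) ≈ prod (λ a → sum (F a))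
  sumPts-prod zero    u F = +-identityʳ 1#
  sumPts-prod (suc n) u F = begin
    sumPts (suc n) u (λ z → prod (λ a → F a (z a)))
      ≈⟨ sumPts-suc n u _ ⟩
    ∑[ i < u zero ] sumPts n (u ∘ suc) (λ p → F zero i * prod (λ a → F (suc a) (p a)))
      ≈⟨ sum-cong-≋ {u zero} (λ i → *-distribˡ-sumL (allPts n (u ∘ suc)) (F zero i) _) ⟨
    ∑[ i < u zero ] (F zero i * sumPts n (u ∘ suc) (λ p → prod (λ a → F (suc a) (p a))))
      ≈⟨ sum-cong-≋ {u zero} (λ i → *-congˡ (sumPts-prod n (u ∘ suc) (F ∘ suc))) ⟩
    ∑[ i < u zero ] (F zero i * prod (λ a → sum (F (suc a))))
      ≈⟨ *-distribʳ-sum _ (F zero) ⟨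
    prod (λ a → sum (F a)) ∎

  sumPts-single : ∀ n (u : Fin n → ℕ) (z : Pt n u) (f : Pt n u → Carrier) →
                  (∀ p → ¬ (p ≐ z) → f p ≈ 0#) → (∀ p → p ≐ z → f p ≈ f z) → sumPts n u f ≈ f z
  sumPts-single zero    u z f off at = trans (+-identityʳ _) (at _ λ ())
  sumPts-single (suc n) u z f off at = begin
    sumPts (suc n) u f                              ≈⟨ sumPts-suc n u f ⟩
    ∑[ i < u zero ] sumPts n (u ∘ suc) (f ∘ consPt i) ≈⟨ sum-single (z zero) _ off-head ⟩
    sumPts n (u ∘ suc) (f ∘ consPt (z zero))
      ≈⟨ sumPts-single n (u ∘ suc) (z ∘ suc) _ off-tail at-tail ⟩
    f (consPt (z zero) (z ∘ suc))                   ≈⟨ at _ (cons≐ ≡.refl λ _ → ≡.refl) ⟩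
    f z                                             ∎
    where
    cons≐ : ∀ {i p} → i ≡ z zero → p ≐ (z ∘ suc) → consPt i p ≐ z
    cons≐ i≡ p≐ zero    = i≡
    cons≐ i≡ p≐ (suc a) = p≐ a
    off-head : ∀ i → i ≢ z zero → sumPts n (u ∘ suc) (f ∘ consPt i) ≈ 0#
    off-head i i≢ = sumL-zero (allPts n (u ∘ suc)) λ p → off _ λ c≐z → i≢ (c≐z zero)
    off-tail : ∀ p → ¬ (p ≐ z ∘ suc) → f (consPt (z zero) p) ≈ 0#
    off-tail p p≭ = off _ λ c≐z → p≭ (c≐z ∘ suc)
    at-tail : ∀ p → p ≐ z ∘ suc → f (consPt (z zero) p) ≈ f (consPt (z zero) (z ∘ suc))
    at-tail p p≐ = trans (at _ (cons≐ ≡.refl p≐)) (sym (at _ (cons≐ ≡.refl λ _ → ≡.refl)))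

-- The algebra of a single coordinate U_a = Fin m, with base point ξ = x_a.
module LocalAlgebra {c ℓ} (R : CommutativeRing c ℓ) {m : ℕ} (ξ : Fin m) where
  open CommutativeRing R hiding (zero)
  open Sums R
  open import Algebra.Properties.Ring ring using (x[y-z]≈xy-xz)
  open import Relation.Binary.Reasoning.Setoid setoid

  LocalMat : Set c
  LocalMat = Fin m → Fin m → Carrier

  infixl 7 _⋆_
  _⋆_ : LocalMat → LocalMat → LocalMat
  (L ⋆ L′) i k = ∑[ j < m ] (L i j * L′ j k)

  -- With b = (a ∈ ℙ(g)), adj b and dual b are the factors of A_g and E*_g at the coordinate a,
  -- and related? b i k says whether i, k fit R_g there (they differ exactly when b).
  related? : Bool → Fin m → Fin m → Bool
  related? b i k = if b then not ⌊ i ≟ᶠ k ⌋ else ⌊ i ≟ᶠ k ⌋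

  related?-cong : ∀ b {i k i′ k′} → (i ≡ k → i′ ≡ k′) → (i′ ≡ k′ → i ≡ k) →
                  related? b i k ≡ related? b i′ k′
  related?-cong b to from = ≡.cong (λ e → if b then not e else e) (⌊⌋-≡ (_ ≟ᶠ _) (_ ≟ᶠ _) to from)

  related?-sym : ∀ b i k → related? b i k ≡ related? b k i
  related?-sym b i k = related?-cong b ≡.sym ≡.sym

  adj : Bool → LocalMat
  adj b i k = ind (related? b i k)

  dual : Bool → LocalMat
  dual b i k = ind ⌊ i ≟ᶠ k ⌋ * ind (related? b ξ i)

  δ-sumˡ : ∀ i (f : Fin m → Carrier) → ∑[ j < m ] (ind ⌊ i ≟ᶠ j ⌋ * f j) ≈ f i
  δ-sumˡ i f = trans (sum-single i _ off) (trans (*-congʳ (reflexive (ind-yes (i ≟ᶠ i) ≡.refl))) (*-identityˡ _))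
    where
    off : ∀ j → j ≢ i → ind ⌊ i ≟ᶠ j ⌋ * f j ≈ 0#
    off j j≢i = trans (*-congʳ (reflexive (ind-no (i ≟ᶠ j) (j≢i ∘ ≡.sym)))) (zeroˡ _)

  δ-sumʳ : ∀ k (f : Fin m → Carrier) → ∑[ j < m ] (f j * ind ⌊ j ≟ᶠ k ⌋) ≈ f k
  δ-sumʳ k f = trans (sum-cong-≋ {m} (λ j → trans (*-comm _ _)
                       (*-congʳ (reflexive (≡.cong ind (⌊⌋-≡ (j ≟ᶠ k) (k ≟ᶠ j) ≡.sym ≡.sym))))))
                     (δ-sumˡ k f)

  dual-⋆ : ∀ b (M : LocalMat) i k → (dual b ⋆ M) i k ≈ ind (related? b ξ i) * M i k
  dual-⋆ b M i k =
    trans (sum-cong-≋ {m} (λ j → *-assoc _ _ (M j k))) (δ-sumˡ i (λ j → ind (related? b ξ i) * M j k))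

  ⋆-dual : ∀ b (M : LocalMat) i k → (M ⋆ dual b) i k ≈ M i k * ind (related? b ξ k)
  ⋆-dual b M i k = trans (sum-cong-≋ {m} (λ j → swap (M i j) _ (ind (related? b ξ j))))
                         (δ-sumʳ k (λ j → M i j * ind (related? b ξ j)))
    where
    swap : ∀ x y z → x * (y * z) ≈ (x * z) * y
    swap x y z = trans (*-congˡ (*-comm y z)) (sym (*-assoc x z y))

  dual-idem : ∀ b i k → (dual b ⋆ dual b) i k ≈ dual b i k
  dual-idem b i k = begin
    (dual b ⋆ dual b) i k   ≈⟨ dual-⋆ b (dual b) i k ⟩
    d * (δ * d)             ≈⟨ *-assoc d δ d ⟨
    (d * δ) * d             ≈⟨ *-congʳ (*-comm d δ) ⟩
    (δ * d) * d             ≈⟨ *-assoc δ d d ⟩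
    δ * (d * d)             ≈⟨ *-congˡ (ind-idem (related? b ξ i)) ⟩
    δ * d                   ∎
    where
    d δ : Carrier
    d = ind (related? b ξ i)
    δ = ind ⌊ i ≟ᶠ k ⌋

  sandwiched : Bool → Bool → LocalMat → LocalMat
  sandwiched b b′ M i k = (ind (related? b ξ i) * M i k) * ind (related? b′ ξ k)

  sandwich : ∀ b b′ (M : LocalMat) i k → ((dual b ⋆ M) ⋆ dual b′) i k ≈ sandwiched b b′ M i k
  sandwich b b′ M i k = trans (⋆-dual b′ (dual b ⋆ M) i k) (*-congʳ (dual-⋆ b M i k))

  τ : Fin m → Fin m → Fin m → Fin m
  τ = PC.transpose

  τ-left : ∀ p q → τ p q p ≡ q
  τ-left p q rewrite dec-true (p ≟ᶠ p) ≡.refl = ≡.refl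

  τ-fix : ∀ {p q k} → k ≢ p → k ≢ q → τ p q k ≡ k
  τ-fix {p} {q} {k} k≢p k≢q rewrite dec-false (k ≟ᶠ p) k≢p | dec-false (k ≟ᶠ q) k≢q = ≡.refl

  τ-injective : ∀ {p q i k} → τ p q i ≡ τ p q k → i ≡ k
  τ-injective {p} {q} {i} {k} eq =
    ≡.trans (≡.sym (PC.transpose-inverse q p)) (≡.trans (≡.cong (τ q p) eq) (PC.transpose-inverse q p))

  τ-fixes-ξ : ∀ {p q i} → ξ ≢ p → ξ ≢ q → ξ ≡ τ p q i → ξ ≡ i
  τ-fixes-ξ ξ≢p ξ≢q eq = τ-injective (≡.trans (τ-fix ξ≢p ξ≢q) eq)

  τ-fixes-ξ⁻¹ : ∀ {p q i} → ξ ≢ p → ξ ≢ q → ξ ≡ i → ξ ≡ τ p q i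
  τ-fixes-ξ⁻¹ ξ≢p ξ≢q ≡.refl = ≡.sym (τ-fix ξ≢p ξ≢q)

  -- invariance under the stabiliser of ξ, which transpositions generate
  Invariant : LocalMat → Set ℓ
  Invariant L = ∀ p q → ξ ≢ p → ξ ≢ q → ∀ i k → L (τ p q i) (τ p q k) ≈ L i k

  adj-invariant : ∀ b → Invariant (adj b)
  adj-invariant b p q _ _ i k = reflexive (≡.cong ind (related?-cong b τ-injective (≡.cong (τ p q))))

  dual-invariant : ∀ b → Invariant (dual b)
  dual-invariant b p q ξ≢p ξ≢q i k = *-cong (adj-invariant false p q ξ≢p ξ≢q i k)
    (reflexive (≡.cong ind (related?-cong b (τ-fixes-ξ ξ≢p ξ≢q) (τ-fixes-ξ⁻¹ ξ≢p ξ≢q))))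

  ⋆-invariant : ∀ {L L′} → Invariant L → Invariant L′ → Invariant (L ⋆ L′)
  ⋆-invariant {L} {L′} inv inv′ p q ξ≢p ξ≢q i k = begin
    ∑[ j < m ] (L (τ p q i) j * L′ j (τ p q k))
      ≈⟨ sum-permute _ (Perm.transpose p q) ⟩
    ∑[ j < m ] (L (τ p q i) (τ p q j) * L′ (τ p q j) (τ p q k))
      ≈⟨ sum-cong-≋ {m} (λ j → *-cong (inv p q ξ≢p ξ≢q i j) (inv′ p q ξ≢p ξ≢q j k)) ⟩
    ∑[ j < m ] (L i j * L′ j k) ∎

  AwayPair : Fin m → Fin m → Set
  AwayPair i k = ξ ≢ i × ξ ≢ k × i ≢ k

  valueAt : ∀ {P : Set} → Dec P → (P → Carrier) → Carrier
  valueAt (yes p) f = f p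
  valueAt (no _)  f = 0#

  valueAt-≈ : ∀ {P : Set} (d : Dec P) {f : P → Carrier} {v} → P → (∀ p → f p ≈ v) → valueAt d f ≈ v
  valueAt-≈ (yes p) _ f≈v = f≈v p
  valueAt-≈ (no ¬p) p _   = ⊥-elim (¬p p)

  awayPoint? : Dec (∃ λ i → ξ ≢ i)
  awayPoint? = any? λ i → ¬? (ξ ≟ᶠ i)

  awayPair? : Dec (∃ λ i → ∃ λ k → AwayPair i k)
  awayPair? = any? λ i → any? λ k → ¬? (ξ ≟ᶠ i) ×-dec (¬? (ξ ≟ᶠ k) ×-dec ¬? (i ≟ᶠ k))

  -- the values of an invariant matrix on its two orbitals away from ξ (0 on an empty orbital)
  diagValue : LocalMat → Carrier
  diagValue L = valueAt awayPoint? (λ (i , _) → L i i)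

  offValue : LocalMat → Carrier
  offValue L = valueAt awayPair? (λ (i , k , _) → L i k)

  module _ {L : LocalMat} (inv : Invariant L) where

    diag-orbit : ∀ {i i′} → ξ ≢ i → ξ ≢ i′ → L i′ i′ ≈ L i i
    diag-orbit {i} {i′} ξ≢i ξ≢i′ =
      trans (reflexive (≡.cong₂ L (≡.sym (τ-left i i′)) (≡.sym (τ-left i i′)))) (inv i i′ ξ≢i ξ≢i′ i i)

    off-orbit : ∀ {i k i′ k′} → AwayPair i k → AwayPair i′ k′ → L i′ k′ ≈ L i k
    off-orbit {i} {k} {i′} {k′} (ξ≢i , ξ≢k , i≢k) (ξ≢i′ , ξ≢k′ , i′≢k′) = begin
      L i′ k′                          ≡⟨ ≡.cong₂ L (τ-fix i′≢k₁ i′≢k′) (τ-left k₁ k′) ⟨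
      L (τ k₁ k′ i′) (τ k₁ k′ k₁)      ≈⟨ inv k₁ k′ ξ≢k₁ ξ≢k′ i′ k₁ ⟩
      L i′ k₁                          ≡⟨ ≡.cong (λ j → L j k₁) (τ-left i i′) ⟨
      L (τ i i′ i) (τ i i′ k)          ≈⟨ inv i i′ ξ≢i ξ≢i′ i k ⟩
      L i k                            ∎
      where
      k₁ : Fin m
      k₁ = τ i i′ k
      ξ≢k₁ : ξ ≢ k₁
      ξ≢k₁ = ξ≢k ∘ τ-fixes-ξ ξ≢i ξ≢i′
      i′≢k₁ : i′ ≢ k₁
      i′≢k₁ i′≡k₁ = i≢k (τ-injective (≡.trans (τ-left i i′) i′≡k₁))

    diagValue-≈ : ∀ {i} → ξ ≢ i → L i i ≈ diagValue L
    diagValue-≈ ξ≢i = sym (valueAt-≈ awayPoint? (_ , ξ≢i) λ (_ , ξ≢i′) → diag-orbit ξ≢i ξ≢i′)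

    offValue-≈ : ∀ {i k} → AwayPair i k → L i k ≈ offValue L
    offValue-≈ away = sym (valueAt-≈ awayPair? (_ , _ , away) λ (_ , _ , away′) → off-orbit away away′)

  data Position (i k : Fin m) : Set where
    at-ξ   : ξ ≡ i → ξ ≡ k → Position i k
    diag   : ξ ≢ i → i ≡ k → Position i k
    off    : AwayPair i k → Position i k
    mixedˡ : ξ ≡ i → ξ ≢ k → Position i k
    mixedʳ : ξ ≢ i → ξ ≡ k → Position i k

  position : ∀ i k → Position i k
  position i k with ξ ≟ᶠ i | ξ ≟ᶠ k | i ≟ᶠ k
  ... | yes ξ≡i | yes ξ≡k | _       = at-ξ ξ≡i ξ≡k
  ... | yes ξ≡i | no ξ≢k  | _       = mixedˡ ξ≡i ξ≢k
  ... | no ξ≢i  | yes ξ≡k | _       = mixedʳ ξ≢i ξ≡k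
  ... | no ξ≢i  | no ξ≢k  | yes i≡k = diag ξ≢i i≡k
  ... | no ξ≢i  | no ξ≢k  | no i≢k  = off (ξ≢i , ξ≢k , i≢k)

  -- The cells {(ξ,ξ)}, the diagonal away from ξ and the off-diagonal away from ξ;
  -- cell o is the local factor of E*_P A_Q E*_P for suitable P, Q.
  away : Fin 3 → Bool
  away 0F = false
  away 1F = true
  away 2F = true

  offDiagonal : Fin 3 → Bool
  offDiagonal 0F = false
  offDiagonal 1F = false
  offDiagonal 2F = true

  cell : Fin 3 → LocalMat
  cell o i k = ind (related? (away o) ξ i ∧ related? (offDiagonal o) i k ∧ related? (away o) ξ k)

  sandwiched-cell : ∀ o i k → sandwiched (away o) (away o) (adj (offDiagonal o)) i k ≈ cell o i k
  sandwiched-cell o i k = ind-∧³ (related? (away o) ξ i) (related? (offDiagonal o) i k) (related? (away o) ξ k)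

  rowSum : LocalMat → Fin m → Carrier
  rowSum M i = ∑[ j < m ] M i j

  awayPart : LocalMat → LocalMat
  awayPart L i k = diagValue L * cell 1F i k + offValue L * cell 2F i k

  awayRowSum : LocalMat → Carrier
  awayRowSum L = valueAt awayPoint? (λ (r , _) → rowSum (awayPart L) r)

  coeff : LocalMat → Fin 3 → Carrier
  coeff L 0F = awayRowSum L
  coeff L 1F = diagValue L
  coeff L 2F = offValue L

  -- Agrees with an invariant L away from ξ. The (ξ,ξ) entry is the row sum of awayPart L on the rows
  -- i ≠ ξ (they all agree), so that all row sums of lift L agree and it commutes with adj true.
  lift : LocalMat → LocalMat
  lift L i k = ∑[ o < 3 ] (coeff L o * cell o i k)

  private
    tail≈0 : ∀ b d → b * 0# + (d * 0# + 0#) ≈ 0#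
    tail≈0 b d = trans (+-cong (zeroʳ b) (trans (+-identityʳ _) (zeroʳ d))) (+-identityˡ 0#)

    select₀ : ∀ a b d → a * 1# + (b * 0# + (d * 0# + 0#)) ≈ a
    select₀ a b d = trans (+-cong (*-identityʳ a) (tail≈0 b d)) (+-identityʳ a)

    select₁ : ∀ a b d → a * 0# + (b * 1# + (d * 0# + 0#)) ≈ b
    select₁ a b d = trans (+-cong (zeroʳ a) (trans (+-cong (*-identityʳ b) (trans (+-identityʳ _) (zeroʳ d)))
                                                   (+-identityʳ b)))
                          (+-identityˡ b)

    select₂ : ∀ a b d → a * 0# + (b * 0# + (d * 1# + 0#)) ≈ d
    select₂ a b d = trans (+-cong (zeroʳ a) (trans (+-cong (zeroʳ b) (+-identityʳ _)) (+-identityˡ _)))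
                          (trans (+-identityˡ _) (*-identityʳ d))

    select-none : ∀ a b d → a * 0# + (b * 0# + (d * 0# + 0#)) ≈ 0#
    select-none a b d = trans (+-cong (zeroʳ a) (tail≈0 b d)) (+-identityˡ 0#)

  module _ (L : LocalMat) where

    lift-at-ξ : lift L ξ ξ ≈ awayRowSum L
    lift-at-ξ with ξ ≟ᶠ ξ
    ... | yes _   = select₀ _ _ _
    ... | no ξ≢ξ = ⊥-elim (ξ≢ξ ≡.refl)

    lift-diag : ∀ {i} → ξ ≢ i → lift L i i ≈ diagValue L
    lift-diag {i} ξ≢i with ξ ≟ᶠ i | i ≟ᶠ i
    ... | yes ξ≡i | _       = ⊥-elim (ξ≢i ξ≡i)
    ... | no _    | yes _   = select₁ _ _ _
    ... | no _    | no i≢i  = ⊥-elim (i≢i ≡.refl)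

    lift-off : ∀ {i k} → AwayPair i k → lift L i k ≈ offValue L
    lift-off {i} {k} (ξ≢i , ξ≢k , i≢k) with ξ ≟ᶠ i | ξ ≟ᶠ k | i ≟ᶠ k
    ... | yes ξ≡i | _       | _       = ⊥-elim (ξ≢i ξ≡i)
    ... | no _    | yes ξ≡k | _       = ⊥-elim (ξ≢k ξ≡k)
    ... | no _    | no _    | yes i≡k = ⊥-elim (i≢k i≡k)
    ... | no _    | no _    | no _    = select₂ _ _ _

    lift-mixedˡ : ∀ {i k} → ξ ≡ i → ξ ≢ k → lift L i k ≈ 0#
    lift-mixedˡ {i} {k} ξ≡i ξ≢k with ξ ≟ᶠ i | ξ ≟ᶠ k | i ≟ᶠ k
    ... | no ξ≢i | _       | _       = ⊥-elim (ξ≢i ξ≡i)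
    ... | yes _  | yes ξ≡k | _       = ⊥-elim (ξ≢k ξ≡k)
    ... | yes _  | no _    | yes i≡k = ⊥-elim (ξ≢k (≡.trans ξ≡i i≡k))
    ... | yes _  | no _    | no _    = select-none _ _ _

    lift-mixedʳ : ∀ {i k} → ξ ≢ i → ξ ≡ k → lift L i k ≈ 0#
    lift-mixedʳ {i} {k} ξ≢i ξ≡k with ξ ≟ᶠ i | ξ ≟ᶠ k | i ≟ᶠ k
    ... | yes ξ≡i | _      | _       = ⊥-elim (ξ≢i ξ≡i)
    ... | no _    | no ξ≢k | _       = ⊥-elim (ξ≢k ξ≡k)
    ... | no _    | yes _  | yes i≡k = ⊥-elim (ξ≢i (≡.trans ξ≡k (≡.sym i≡k)))
    ... | no _    | yes _  | no _    = select-none _ _ _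

  cell-invariant : ∀ o → Invariant (cell o)
  cell-invariant o p q ξ≢p ξ≢q i k = reflexive (≡.cong ind (≡.cong₂ _∧_ (at-ξ-invariant i)
    (≡.cong₂ _∧_ (related?-cong (offDiagonal o) τ-injective (≡.cong (τ p q))) (at-ξ-invariant k))))
    where
    at-ξ-invariant : ∀ j → related? (away o) ξ (τ p q j) ≡ related? (away o) ξ j
    at-ξ-invariant j = related?-cong (away o) (τ-fixes-ξ ξ≢p ξ≢q) (τ-fixes-ξ⁻¹ ξ≢p ξ≢q)

  awayPart-invariant : ∀ L → Invariant (awayPart L)
  awayPart-invariant L p q ξ≢p ξ≢q i k =
    +-cong (*-congˡ (cell-invariant 1F p q ξ≢p ξ≢q i k)) (*-congˡ (cell-invariant 2F p q ξ≢p ξ≢q i k))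

  rowSum-invariant : ∀ {M} → Invariant M → ∀ {i r} → ξ ≢ i → ξ ≢ r → rowSum M r ≈ rowSum M i
  rowSum-invariant {M} inv {i} {r} ξ≢i ξ≢r = begin
    ∑[ j < m ] M r j                        ≈⟨ sum-permute (M r) (Perm.transpose i r) ⟩
    ∑[ j < m ] M r (τ i r j)                ≡⟨ ≡.cong (λ r′ → sum (M r′ ∘ τ i r)) (τ-left i r) ⟨
    ∑[ j < m ] M (τ i r i) (τ i r j)        ≈⟨ sum-cong-≋ {m} (inv i r ξ≢i ξ≢r i) ⟩
    ∑[ j < m ] M i j                        ∎

  module _ (L : LocalMat) where

    lift-away-row : ∀ {i} → ξ ≢ i → ∀ j → lift L i j ≈ awayPart L i j
    lift-away-row {i} ξ≢i j with ξ ≟ᶠ i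
    ... | yes ξ≡i = ⊥-elim (ξ≢i ξ≡i)
    ... | no _    = trans (+-cong (zeroʳ _) (+-congˡ (+-identityʳ _))) (+-identityˡ _)

    lift-row-sum : ∀ i → rowSum (lift L) i ≈ awayRowSum L
    lift-row-sum i = by-cases (ξ ≟ᶠ i)
      where
      by-cases : Dec (ξ ≡ i) → rowSum (lift L) i ≈ awayRowSum L
      by-cases (yes ≡.refl) = trans (sum-single ξ (lift L ξ) λ j j≢ξ → lift-mixedˡ L ≡.refl (j≢ξ ∘ ≡.sym))
                                    (lift-at-ξ L)
      by-cases (no ξ≢i) = trans (sum-cong-≋ {m} (lift-away-row ξ≢i))
        (sym (valueAt-≈ awayPoint? (i , ξ≢i) λ (_ , ξ≢r) → rowSum-invariant (awayPart-invariant L) ξ≢i ξ≢r))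

    lift-sym : ∀ i k → lift L i k ≈ lift L k i
    lift-sym i k with position i k
    ... | at-ξ ≡.refl ≡.refl = refl
    ... | diag _ ≡.refl = refl
    ... | off (ξ≢i , ξ≢k , i≢k) =
      trans (lift-off L (ξ≢i , ξ≢k , i≢k)) (sym (lift-off L (ξ≢k , ξ≢i , i≢k ∘ ≡.sym)))
    ... | mixedˡ ξ≡i ξ≢k = trans (lift-mixedˡ L ξ≡i ξ≢k) (sym (lift-mixedʳ L ξ≢k ξ≡i))
    ... | mixedʳ ξ≢i ξ≡k = trans (lift-mixedʳ L ξ≢i ξ≡k) (sym (lift-mixedˡ L ξ≡k ξ≢i))

    lift-column-sum : ∀ k → ∑[ j < m ] lift L j k ≈ awayRowSum L
    lift-column-sum k = trans (sum-cong-≋ {m} (λ j → lift-sym j k)) (lift-row-sum k)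

  indAway-at : ∀ {j} → ξ ≡ j → ind (related? true ξ j) ≈ 0#
  indAway-at {j} ξ≡j with ξ ≟ᶠ j
  ... | yes _   = refl
  ... | no ξ≢j = ⊥-elim (ξ≢j ξ≡j)

  indAway-away : ∀ {j} → ξ ≢ j → ind (related? true ξ j) ≈ 1#
  indAway-away {j} ξ≢j with ξ ≟ᶠ j
  ... | yes ξ≡j = ⊥-elim (ξ≢j ξ≡j)
  ... | no _    = refl

  ⋆-adj-true : ∀ (f : Fin m → Carrier) k → ∑[ j < m ] (f j * adj true j k) ≈ sum f - f k
  ⋆-adj-true f k = begin
    ∑[ j < m ] (f j * ind (not ⌊ j ≟ᶠ k ⌋))                ≈⟨ sum-cong-≋ {m} (λ j → *-congˡ (ind-not _)) ⟩
    ∑[ j < m ] (f j * (1# - ind ⌊ j ≟ᶠ k ⌋))               ≈⟨ sum-cong-≋ {m} (λ j → x[1-y]≈x-xy (f j) _) ⟩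
    ∑[ j < m ] (f j - f j * ind ⌊ j ≟ᶠ k ⌋)                ≈⟨ ∑-distrib-+ f _ ⟩
    sum f + (∑[ j < m ] (- (f j * ind ⌊ j ≟ᶠ k ⌋)))        ≈⟨ +-congˡ (sum-neg {m} _) ⟩
    sum f - (∑[ j < m ] (f j * ind ⌊ j ≟ᶠ k ⌋))            ≈⟨ +-congˡ (-‿cong (δ-sumʳ k f)) ⟩
    sum f - f k                                            ∎
    where
    x[1-y]≈x-xy : ∀ x y → x * (1# - y) ≈ x - x * y
    x[1-y]≈x-xy x y = trans (x[y-z]≈xy-xz x 1# y) (+-congʳ (*-identityʳ x))

  adj-true-⋆ : ∀ (f : Fin m → Carrier) i → ∑[ j < m ] (adj true i j * f j) ≈ sum f - f i
  adj-true-⋆ f i =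
    trans (sum-cong-≋ {m} λ j → trans (*-comm _ _) (*-congˡ (reflexive (≡.cong ind (related?-sym true i j)))))
          (⋆-adj-true f i)

  module _ {L : LocalMat} where

    private
      vanishing-commutes : ∀ {i k} → lift L i k ≈ 0# → ∀ y z → lift L i k * y ≈ z * lift L i k
      vanishing-commutes L≈0 y z = trans (*-congʳ L≈0) (trans (zeroˡ y) (sym (trans (*-congˡ L≈0) (zeroʳ z))))

    lift-commutes-dual : ∀ b i k → (lift L ⋆ dual b) i k ≈ (dual b ⋆ lift L) i k
    lift-commutes-dual b i k =
      trans (⋆-dual b (lift L) i k) (trans (by-position (position i k)) (sym (dual-⋆ b (lift L) i k)))
      where
      by-position : Position i k → lift L i k * ind (related? b ξ k) ≈ ind (related? b ξ i) * lift L i k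
      by-position (at-ξ ≡.refl ≡.refl) = *-comm _ _
      by-position (diag _ ≡.refl)      = *-comm _ _
      by-position (off (ξ≢i , ξ≢k , _)) = trans (*-comm _ _)
        (*-congʳ (reflexive (≡.cong ind (related?-cong b (⊥-elim ∘ ξ≢k) (⊥-elim ∘ ξ≢i)))))
      by-position (mixedˡ ξ≡i ξ≢k) = vanishing-commutes (lift-mixedˡ L ξ≡i ξ≢k) _ _
      by-position (mixedʳ ξ≢i ξ≡k) = vanishing-commutes (lift-mixedʳ L ξ≢i ξ≡k) _ _

    lift-commutes-adj : ∀ b i k → (lift L ⋆ adj b) i k ≈ (adj b ⋆ lift L) i k
    lift-commutes-adj false i k = trans (δ-sumʳ k (lift L i)) (sym (δ-sumˡ i (λ j → lift L j k)))
    lift-commutes-adj true  i k = begin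
      ∑[ j < m ] (lift L i j * adj true j k)   ≈⟨ ⋆-adj-true (lift L i) k ⟩
      rowSum (lift L) i - lift L i k           ≈⟨ +-congʳ (trans (lift-row-sum L i) (sym (lift-column-sum L k))) ⟩
      ∑[ j < m ] lift L j k - lift L i k       ≈⟨ adj-true-⋆ (λ j → lift L j k) i ⟨
      ∑[ j < m ] (adj true i j * lift L j k)   ∎

  module _ {L : LocalMat} (inv : Invariant L) where

    lift-agrees : ∀ {i k} → ξ ≢ i → ξ ≢ k → lift L i k ≈ L i k
    lift-agrees {i} {k} ξ≢i ξ≢k with position i k
    ... | diag _ ≡.refl = trans (lift-diag L ξ≢i) (sym (diagValue-≈ inv ξ≢i))
    ... | off away      = trans (lift-off L away) (sym (offValue-≈ inv away))
    ... | at-ξ ξ≡i _    = ⊥-elim (ξ≢i ξ≡i)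
    ... | mixedˡ ξ≡i _  = ⊥-elim (ξ≢i ξ≡i)
    ... | mixedʳ _ ξ≡k  = ⊥-elim (ξ≢k ξ≡k)

    lift-corner : ∀ i k → (lift L ⋆ dual true) i k ≈ ((dual true ⋆ L) ⋆ dual true) i k
    lift-corner i k =
      trans (⋆-dual true (lift L) i k) (trans (by-position (position i k)) (sym (sandwich true true L i k)))
      where
      both-vanish : ∀ {y z} → ind (related? true ξ k) ≈ 0# →
                    y * ind (related? true ξ k) ≈ z * ind (related? true ξ k)
      both-vanish k-at = trans (*-congˡ k-at) (trans (zeroʳ _) (sym (trans (*-congˡ k-at) (zeroʳ _))))
      by-position : Position i k →
        lift L i k * ind (related? true ξ k) ≈ (ind (related? true ξ i) * L i k) * ind (related? true ξ k)
      by-position (at-ξ _ ξ≡k)     = both-vanish (indAway-at ξ≡k)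
      by-position (mixedʳ _ ξ≡k)   = both-vanish (indAway-at ξ≡k)
      by-position (mixedˡ ξ≡i ξ≢k) = *-congʳ (trans (lift-mixedˡ L ξ≡i ξ≢k)
        (sym (trans (*-congʳ (indAway-at ξ≡i)) (zeroˡ _))))
      by-position (diag ξ≢i ≡.refl) = *-congʳ (trans (lift-agrees ξ≢i ξ≢i)
        (sym (trans (*-congʳ (indAway-away ξ≢i)) (*-identityˡ _))))
      by-position (off (ξ≢i , ξ≢k , _)) = *-congʳ (trans (lift-agrees ξ≢i ξ≢k)
        (sym (trans (*-congʳ (indAway-away ξ≢i)) (*-identityˡ _))))

  dual-true-away-row : ∀ {i} → ξ ≢ i → ∀ k → dual true i k ≈ ind ⌊ i ≟ᶠ k ⌋
  dual-true-away-row ξ≢i k = trans (*-congˡ (indAway-away ξ≢i)) (*-identityʳ _)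

  dual-true-away-col : ∀ {k} → ξ ≢ k → ∀ i → dual true i k ≈ ind ⌊ i ≟ᶠ k ⌋
  dual-true-away-col {k} ξ≢k i with i ≟ᶠ k
  ... | yes ≡.refl = trans (*-congˡ (indAway-away ξ≢k)) (*-identityʳ _)
  ... | no _       = zeroˡ _

  -- Selecting the entries of a matrix through rows and columns away from ξ.
  module _ {ρ : Fin m} (ξ≢ρ : ξ ≢ ρ) where

    shift : Fin m → Fin m
    shift t = if ⌊ ξ ≟ᶠ t ⌋ then ρ else t

    shift-away : ∀ t → ξ ≢ shift t
    shift-away t with ξ ≟ᶠ t
    ... | yes _   = ξ≢ρ
    ... | no ξ≢t = ξ≢t

    selector-bits : ∀ t p → related? true ξ (shift t) ∧ related? ⌊ ξ ≟ᶠ t ⌋ (shift t) p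
                              ∧ related? (not ⌊ ξ ≟ᶠ t ⌋) ξ p
                            ≡ ⌊ t ≟ᶠ p ⌋
    selector-bits t p with ξ ≟ᶠ t
    selector-bits t p | yes ξ≡t with ξ ≟ᶠ ρ | ρ ≟ᶠ p | ξ ≟ᶠ p | t ≟ᶠ p
    ... | yes ξ≡ρ | _       | _       | _       = ⊥-elim (ξ≢ρ ξ≡ρ)
    ... | no _    | yes ρ≡p | _       | yes t≡p = ⊥-elim (ξ≢ρ (≡.trans ξ≡t (≡.trans t≡p (≡.sym ρ≡p))))
    ... | no _    | yes _   | _       | no _    = ≡.refl
    ... | no _    | no _    | yes _   | yes _   = ≡.refl
    ... | no _    | no _    | yes ξ≡p | no t≢p  = ⊥-elim (t≢p (≡.trans (≡.sym ξ≡t) ξ≡p))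
    ... | no _    | no _    | no ξ≢p  | yes t≡p = ⊥-elim (ξ≢p (≡.trans ξ≡t t≡p))
    ... | no _    | no _    | no _    | no _    = ≡.refl
    selector-bits t p | no ξ≢t with ξ ≟ᶠ t | t ≟ᶠ p | ξ ≟ᶠ p
    ... | yes ξ≡t | _       | _       = ⊥-elim (ξ≢t ξ≡t)
    ... | no _    | yes t≡p | yes ξ≡p = ⊥-elim (ξ≢t (≡.trans ξ≡p (≡.sym t≡p)))
    ... | no _    | yes _   | no _    = ≡.refl
    ... | no _    | no _    | _       = ≡.refl

    selector-row : ∀ t p →
                   sandwiched true (not ⌊ ξ ≟ᶠ t ⌋) (adj ⌊ ξ ≟ᶠ t ⌋) (shift t) p ≈ ind ⌊ t ≟ᶠ p ⌋
    selector-row t p = trans (ind-∧³ _ _ _) (reflexive (≡.cong ind (selector-bits t p)))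

    selector-col : ∀ s q →
                   sandwiched (not ⌊ ξ ≟ᶠ s ⌋) true (adj ⌊ ξ ≟ᶠ s ⌋) q (shift s) ≈ ind ⌊ q ≟ᶠ s ⌋
    selector-col s q = begin
      (r * adj b q (shift s)) * d            ≈⟨ *-comm _ d ⟩
      d * (r * adj b q (shift s))            ≈⟨ *-congˡ (*-comm r _) ⟩
      d * (adj b q (shift s) * r)            ≈⟨ *-assoc d _ r ⟨
      (d * adj b q (shift s)) * r            ≈⟨ *-congʳ (*-congˡ (reflexive (≡.cong ind (related?-sym b q _)))) ⟩
      (d * adj b (shift s) q) * r            ≈⟨ selector-row s q ⟩
      ind ⌊ s ≟ᶠ q ⌋                         ≡⟨ ≡.cong ind (⌊⌋-≡ (s ≟ᶠ q) (q ≟ᶠ s) ≡.sym ≡.sym) ⟩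
      ind ⌊ q ≟ᶠ s ⌋                         ∎
      where
      b : Bool
      b = ⌊ ξ ≟ᶠ s ⌋
      r d : Carrier
      r = ind (related? (not b) ξ q)
      d = ind (related? true ξ (shift s))

module FactorialTerwilliger {c ℓ} (𝔽 : Field c ℓ) (n : ℕ) (u : Fin n → ℕ) (x : Pt n u) where
  open Field 𝔽 hiding (zero)
  open Terwilliger 𝔽 n u
  open Sums commutativeRing
  module Local (a : Fin n) = LocalAlgebra commutativeRing (x a)
  open import Algebra.Properties.Ring ring using (-1*x≈-x)
  module ≈-Reasoning = SetoidReasoning setoid

  ≈ₘ-setoid : Setoid c ℓ
  ≈ₘ-setoid = record
    { Carrier = Mat ; _≈_ = _≈ₘ_
    ; isEquivalence = record
      { refl  = λ v w → refl
      ; sym   = λ M≈N v w → sym (M≈N v w)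
      ; trans = λ L≈M M≈N v w → trans (L≈M v w) (M≈N v w) } }

  module ≈ₘ = Setoid ≈ₘ-setoid
  module ≈ₘ-Reasoning = SetoidReasoning ≈ₘ-setoid

  ⊕-cong : ∀ {M M′ N N′} → M ≈ₘ M′ → N ≈ₘ N′ → (M ⊕ N) ≈ₘ (M′ ⊕ N′)
  ⊕-cong M≈ N≈ v w = +-cong (M≈ v w) (N≈ v w)

  ·-cong : ∀ k {M M′} → M ≈ₘ M′ → (k · M) ≈ₘ (k · M′)
  ·-cong k M≈ v w = *-congˡ (M≈ v w)

  ⊗-cong : ∀ {M M′ N N′} → M ≈ₘ M′ → N ≈ₘ N′ → (M ⊗ N) ≈ₘ (M′ ⊗ N′)
  ⊗-cong M≈ N≈ v w = sumL-cong (allPts n u) (λ z → *-cong (M≈ v z) (N≈ z w))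

  ⊗-assoc : ∀ L M N → ((L ⊗ M) ⊗ N) ≈ₘ (L ⊗ (M ⊗ N))
  ⊗-assoc L M N v w = begin
    Σₓ (λ z → Σₓ (λ y → L v y * M y z) * N z w)    ≈⟨ sumL-cong X (λ z → *-distribʳ-sumL X (N z w) _) ⟩
    Σₓ (λ z → Σₓ (λ y → (L v y * M y z) * N z w))  ≈⟨ sumL-comm X X _ ⟩
    Σₓ (λ y → Σₓ (λ z → (L v y * M y z) * N z w))  ≈⟨ sumL-cong X (λ y → sumL-cong X λ z → *-assoc _ _ _) ⟩
    Σₓ (λ y → Σₓ (λ z → L v y * (M y z * N z w)))  ≈⟨ sumL-cong X (λ y → *-distribˡ-sumL X (L v y) _) ⟨
    Σₓ (λ y → L v y * Σₓ (λ z → M y z * N z w))    ∎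
    where
    open ≈-Reasoning
    X : List (Pt n u)
    X = allPts n u

  ⊗-distribˡ : ∀ L M N → (L ⊗ (M ⊕ N)) ≈ₘ ((L ⊗ M) ⊕ (L ⊗ N))
  ⊗-distribˡ L M N v w =
    trans (sumL-cong (allPts n u) (λ z → distribˡ (L v z) (M z w) (N z w))) (sumL-distrib-+ (allPts n u) _ _)

  ⊗-distribʳ : ∀ L M N → ((M ⊕ N) ⊗ L) ≈ₘ ((M ⊗ L) ⊕ (N ⊗ L))
  ⊗-distribʳ L M N v w =
    trans (sumL-cong (allPts n u) (λ z → distribʳ (L z w) (M v z) (N v z))) (sumL-distrib-+ (allPts n u) _ _)

  ·-⊗ : ∀ k M N → ((k · M) ⊗ N) ≈ₘ (k · (M ⊗ N))
  ·-⊗ k M N v w =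
    trans (sumL-cong (allPts n u) (λ z → *-assoc k (M v z) (N z w))) (sym (*-distribˡ-sumL (allPts n u) k _))

  ⊗-· : ∀ k M N → (M ⊗ (k · N)) ≈ₘ (k · (M ⊗ N))
  ⊗-· k M N v w =
    trans (sumL-cong (allPts n u) (λ z → x[ky]≈k[xy] (M v z) (N z w))) (sym (*-distribˡ-sumL (allPts n u) k _))
    where
    x[ky]≈k[xy] : ∀ p q → p * (k * q) ≈ k * (p * q)
    x[ky]≈k[xy] p q = trans (sym (*-assoc p k q)) (trans (*-congʳ (*-comm p k)) (*-assoc k p q))

  ⊗-zeroˡ : ∀ M → (𝟘 ⊗ M) ≈ₘ 𝟘
  ⊗-zeroˡ M v w = sumL-zero (allPts n u) (λ z → zeroˡ _)

  ⊗-zeroʳ : ∀ M → (M ⊗ 𝟘) ≈ₘ 𝟘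
  ⊗-zeroʳ M v w = sumL-zero (allPts n u) (λ z → zeroʳ _)

  -- Matrices respecting the pointwise equality of points; only for these is 𝟙 a unit.
  Ext : Mat → Set ℓ
  Ext M = ∀ {v v′ w w′} → v ≐ v′ → w ≐ w′ → M v w ≈ M v′ w′

  ≐-refl : ∀ {v : Pt n u} → v ≐ v
  ≐-refl a = ≡.refl

  ≐-sym : ∀ {v w : Pt n u} → v ≐ w → w ≐ v
  ≐-sym v≐w a = ≡.sym (v≐w a)

  sum-𝟙ˡ : ∀ t (f : Pt n u → Carrier) → (∀ {p} → p ≐ t → f p ≈ f t) → Σₓ (λ p → 𝟙 t p * f p) ≈ f t
  sum-𝟙ˡ t f f-ext = trans (sumPts-single n u t _ off at)
                           (trans (*-congʳ (reflexive (ind-yes (samePt? t t) ≐-refl))) (*-identityˡ _))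
    where
    off : ∀ p → ¬ (p ≐ t) → 𝟙 t p * f p ≈ 0#
    off p p≭t = trans (*-congʳ (reflexive (ind-no (samePt? t p) (p≭t ∘ ≐-sym)))) (zeroˡ _)
    at : ∀ p → p ≐ t → 𝟙 t p * f p ≈ 𝟙 t t * f t
    at p p≐t = *-cong (reflexive (≡.trans (ind-yes (samePt? t p) (≐-sym p≐t))
                                          (≡.sym (ind-yes (samePt? t t) ≐-refl))))
                      (f-ext p≐t)

  sum-𝟙ʳ : ∀ t (f : Pt n u → Carrier) → (∀ {p} → p ≐ t → f p ≈ f t) → Σₓ (λ p → f p * 𝟙 p t) ≈ f t
  sum-𝟙ʳ t f f-ext =
    trans (sumL-cong (allPts n u) λ p → trans (*-comm _ _) (*-congʳ (𝟙-sym p t))) (sum-𝟙ˡ t f f-ext)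
    where
    𝟙-sym : ∀ p t → 𝟙 p t ≈ 𝟙 t p
    𝟙-sym p t = reflexive (≡.cong ind (⌊⌋-≡ (samePt? p t) (samePt? t p) ≐-sym ≐-sym))

  𝟙-⊗ : ∀ {M} → Ext M → (𝟙 ⊗ M) ≈ₘ M
  𝟙-⊗ {M} M-ext v w = sum-𝟙ˡ v (λ p → M p w) (λ p≐v → M-ext p≐v ≐-refl)

  ⊗-𝟙 : ∀ {M} → Ext M → (M ⊗ 𝟙) ≈ₘ M
  ⊗-𝟙 {M} M-ext v w = sum-𝟙ʳ w (λ p → M v p) (λ p≐w → M-ext ≐-refl p≐w)

  R-resp : ∀ P {v v′ w w′ : Pt n u} → v ≐ v′ → w ≐ w′ → R P v w → R P v′ w′
  R-resp P v≐ w≐ Rvw a = ≡.subst₂ (λ i k → (¬ (i ≡ k)) ⇔ (a ∈ P)) (v≐ a) (w≐ a) (Rvw a)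

  same-resp : ∀ {v v′ w w′ : Pt n u} → v ≐ v′ → w ≐ w′ → v ≐ w → v′ ≐ w′
  same-resp v≐ w≐ v≐w a = ≡.trans (≡.sym (v≐ a)) (≡.trans (v≐w a) (w≐ a))

  ext-𝟙 : Ext 𝟙
  ext-𝟙 v≐ w≐ = reflexive (≡.cong ind
    (⌊⌋-≡ (samePt? _ _) (samePt? _ _) (same-resp v≐ w≐) (same-resp (≐-sym v≐) (≐-sym w≐))))

  ext-A : ∀ P → Ext (A P)
  ext-A P v≐ w≐ = reflexive (≡.cong ind
    (⌊⌋-≡ (R? P _ _) (R? P _ _) (R-resp P v≐ w≐) (R-resp P (≐-sym v≐) (≐-sym w≐))))

  ext-Estar : ∀ P → Ext (Estar x P)
  ext-Estar P v≐ w≐ = reflexive (≡.cong ind (≡.cong₂ _∧_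
    (⌊⌋-≡ (samePt? _ _) (samePt? _ _) (same-resp v≐ w≐) (same-resp (≐-sym v≐) (≐-sym w≐)))
    (⌊⌋-≡ (R? P x _) (R? P x _) (R-resp P ≐-refl v≐) (R-resp P ≐-refl (≐-sym v≐)))))

  ext-⊕ : ∀ {M N} → Ext M → Ext N → Ext (M ⊕ N)
  ext-⊕ M-ext N-ext v≐ w≐ = +-cong (M-ext v≐ w≐) (N-ext v≐ w≐)

  ext-· : ∀ k {M} → Ext M → Ext (k · M)
  ext-· k M-ext v≐ w≐ = *-congˡ (M-ext v≐ w≐)

  ext-⊗ : ∀ {M N} → Ext M → Ext N → Ext (M ⊗ N)
  ext-⊗ M-ext N-ext v≐ w≐ = sumL-cong (allPts n u) (λ z → *-cong (M-ext v≐ ≐-refl) (N-ext ≐-refl w≐))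

  ext-resp : ∀ {M N} → M ≈ₘ N → Ext M → Ext N
  ext-resp {M} {N} M≈N M-ext {v} {v′} {w} {w′} v≐ w≐ =
    trans (sym (M≈N v w)) (trans (M-ext v≐ w≐) (M≈N v′ w′))

  ext-T : ∀ {M} → InT x M → Ext M
  ext-T (genA P)      = ext-A P
  ext-T (genE P)      = ext-Estar P
  ext-T unit          = ext-𝟙
  ext-T (add TM TN)   = ext-⊕ (ext-T TM) (ext-T TN)
  ext-T (smul k TM)   = ext-· k (ext-T TM)
  ext-T (mul TM TN)   = ext-⊗ (ext-T TM) (ext-T TN)
  ext-T (resp M≈N TM) = ext-resp M≈N (ext-T TM)

  ExtMat : Set (c ⊔ ℓ)
  ExtMat = Σ Mat Ext

  extRing : Ring (c ⊔ ℓ) ℓ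
  extRing = record
    { Carrier = ExtMat
    ; _≈_ = λ M N → proj₁ M ≈ₘ proj₁ N
    ; _+_ = λ M N → proj₁ M ⊕ proj₁ N , ext-⊕ (proj₂ M) (proj₂ N)
    ; _*_ = λ M N → proj₁ M ⊗ proj₁ N , ext-⊗ (proj₂ M) (proj₂ N)
    ; -_ = λ M → (- 1#) · proj₁ M , ext-· (- 1#) (proj₂ M)
    ; 0# = 𝟘 , λ _ _ → refl
    ; 1# = 𝟙 , ext-𝟙
    ; isRing = record
      { +-isAbelianGroup = record
        { isGroup = record
          { isMonoid = record
            { isSemigroup = record
              { isMagma = record
                { isEquivalence = record { refl = ≈ₘ.refl ; sym = ≈ₘ.sym ; trans = ≈ₘ.trans }
                ; ∙-cong = ⊕-cong }
              ; assoc = λ _ _ _ v w → +-assoc _ _ _ }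
            ; identity = (λ _ v w → +-identityˡ _) , (λ _ v w → +-identityʳ _) }
          ; inverse = (λ _ v w → trans (+-congʳ (-1*x≈-x _)) (-‿inverseˡ _))
                    , (λ _ v w → trans (+-congˡ (-1*x≈-x _)) (-‿inverseʳ _))
          ; ⁻¹-cong = ·-cong (- 1#) }
        ; comm = λ _ _ v w → +-comm _ _ }
      ; *-cong = ⊗-cong
      ; *-assoc = λ L M N → ⊗-assoc (proj₁ L) (proj₁ M) (proj₁ N)
      ; *-identity = (λ M → 𝟙-⊗ (proj₂ M)) , (λ M → ⊗-𝟙 (proj₂ M))
      ; distrib = (λ L M N → ⊗-distribˡ (proj₁ L) (proj₁ M) (proj₁ N))
                , (λ L M N → ⊗-distribʳ (proj₁ L) (proj₁ M) (proj₁ N)) } }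

  -- Tensor decomposition

  Family : Set c
  Family = (a : Fin n) → Local.LocalMat a

  tens : Family → Mat
  tens F v w = prod (λ a → F a (v a) (w a))

  infixl 7 _⋆ᶠ_
  _⋆ᶠ_ : Family → Family → Family
  (F ⋆ᶠ G) a = Local._⋆_ a (F a) (G a)

  tens-⊗ : ∀ F G → (tens F ⊗ tens G) ≈ₘ tens (F ⋆ᶠ G)
  tens-⊗ F G v w = begin
    Σₓ (λ z → prod (λ a → F a (v a) (z a)) * prod (λ a → G a (z a) (w a)))
      ≈⟨ sumL-cong (allPts n u) (λ z → sym (prod-distrib-* {n} _ _)) ⟩
    Σₓ (λ z → prod (λ a → F a (v a) (z a) * G a (z a) (w a)))
      ≈⟨ sumPts-prod n u (λ a j → F a (v a) j * G a j (w a)) ⟩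
    tens (F ⋆ᶠ G) v w ∎
    where open ≈-Reasoning

  tens-cong : ∀ {F G : Family} → (∀ a i k → F a i k ≈ G a i k) → tens F ≈ₘ tens G
  tens-cong F≈G v w = prod-cong (λ a → F≈G a (v a) (w a))

  ext-tens : ∀ F → Ext (tens F)
  ext-tens F v≐ w≐ = prod-cong (λ a → reflexive (≡.cong₂ (F a) (v≐ a) (w≐ a)))

  A-tens : ∀ P → A P ≈ₘ tens (λ a → Local.adj a ⌊ a ∈? P ⌋)
  A-tens P v w =
    trans (ind-all? _) (prod-cong λ a → reflexive (≡.cong ind (⌊¬?⇔?⌋ (v a ≟ᶠ w a) (a ∈? P))))

  Estar-tens : ∀ P → Estar x P ≈ₘ tens (λ a → Local.dual a ⌊ a ∈? P ⌋)
  Estar-tens P v w = begin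
    ind (⌊ samePt? v w ⌋ ∧ ⌊ R? P x v ⌋)                         ≈⟨ ind-∧ _ _ ⟩
    ind ⌊ samePt? v w ⌋ * ind ⌊ R? P x v ⌋                       ≈⟨ *-cong (ind-all? _) (ind-all? _) ⟩
    prod (λ a → ind ⌊ v a ≟ᶠ w a ⌋) * prod (λ a → ind ⌊ ¬? (x a ≟ᶠ v a) ⇔? (a ∈? P) ⌋)
      ≈⟨ *-congˡ (prod-cong λ a → reflexive (≡.cong ind (⌊¬?⇔?⌋ (x a ≟ᶠ v a) (a ∈? P)))) ⟩
    prod (λ a → ind ⌊ v a ≟ᶠ w a ⌋) * prod (λ a → ind (Local.related? a ⌊ a ∈? P ⌋ (x a) (v a)))
      ≈⟨ prod-distrib-* {n} _ _ ⟨
    tens (λ a → Local.dual a ⌊ a ∈? P ⌋) v w                     ∎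
    where open ≈-Reasoning

  𝟙-tens : 𝟙 ≈ₘ tens (λ a → Local.adj a false)
  𝟙-tens v w = ind-all? _

  Invariant : Family → Set ℓ
  Invariant F = ∀ a → Local.Invariant a (F a)

  Term : Set c
  Term = Carrier × Family

  combination : List Term → Mat
  combination []             = 𝟘
  combination ((k , F) ∷ ts) = (k · tens F) ⊕ combination ts

  InvariantSpan : Mat → Set (c ⊔ ℓ)
  InvariantSpan M = Σ (List Term) λ ts → All (Invariant ∘ proj₂) ts × M ≈ₘ combination ts

  combination-++ : ∀ ts ts′ → combination (ts ++ ts′) ≈ₘ (combination ts ⊕ combination ts′)
  combination-++ []       ts′ v w = sym (+-identityˡ _)
  combination-++ (t ∷ ts) ts′ v w = trans (+-congˡ (combination-++ ts ts′ v w)) (sym (+-assoc _ _ _))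

  scale : Carrier → Term → Term
  scale k (k′ , F) = k * k′ , F

  combination-scale : ∀ k ts → combination (map (scale k) ts) ≈ₘ (k · combination ts)
  combination-scale k []       v w = sym (zeroʳ k)
  combination-scale k (t ∷ ts) v w =
    trans (+-cong (*-assoc k _ _) (combination-scale k ts v w)) (sym (distribˡ k _ _))

  _⋆ₜ_ : Term → Term → Term
  (k , F) ⋆ₜ (k′ , G) = k * k′ , F ⋆ᶠ G

  term-⊗ : ∀ k F k′ G → ((k · tens F) ⊗ (k′ · tens G)) ≈ₘ ((k * k′) · tens (F ⋆ᶠ G))
  term-⊗ k F k′ G = begin
    (k · tens F) ⊗ (k′ · tens G)             ≈⟨ ·-⊗ k (tens F) _ ⟩
    k · (tens F ⊗ (k′ · tens G))             ≈⟨ ·-cong k (⊗-· k′ (tens F) (tens G)) ⟩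
    k · (k′ · (tens F ⊗ tens G))             ≈⟨ ·-cong k (·-cong k′ (tens-⊗ F G)) ⟩
    k · (k′ · tens (F ⋆ᶠ G))                 ≈⟨ (λ v w → sym (*-assoc k k′ _)) ⟩
    (k * k′) · tens (F ⋆ᶠ G)                 ∎
    where open ≈ₘ-Reasoning

  combination-⊗ : ∀ ts ts′ →
                  (combination ts ⊗ combination ts′) ≈ₘ combination (cartesianProductWith _⋆ₜ_ ts ts′)
  combination-⊗ []       ts′ = ⊗-zeroˡ _
  combination-⊗ (t ∷ ts) ts′ = begin
    ((proj₁ t · tens (proj₂ t)) ⊕ combination ts) ⊗ combination ts′
      ≈⟨ ⊗-distribʳ _ _ _ ⟩
    ((proj₁ t · tens (proj₂ t)) ⊗ combination ts′) ⊕ (combination ts ⊗ combination ts′)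
      ≈⟨ ⊕-cong (single-⊗ t ts′) (combination-⊗ ts ts′) ⟩
    combination (map (t ⋆ₜ_) ts′) ⊕ combination (cartesianProductWith _⋆ₜ_ ts ts′)
      ≈⟨ combination-++ (map (t ⋆ₜ_) ts′) _ ⟨
    combination (map (t ⋆ₜ_) ts′ ++ cartesianProductWith _⋆ₜ_ ts ts′) ∎
    where
    open ≈ₘ-Reasoning
    single-⊗ : ∀ t ts′ → ((proj₁ t · tens (proj₂ t)) ⊗ combination ts′) ≈ₘ combination (map (t ⋆ₜ_) ts′)
    single-⊗ t []         = ⊗-zeroʳ _
    single-⊗ t (t′ ∷ ts′) = begin
      (proj₁ t · tens (proj₂ t)) ⊗ ((proj₁ t′ · tens (proj₂ t′)) ⊕ combination ts′)
        ≈⟨ ⊗-distribˡ _ _ _ ⟩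
      ((proj₁ t · tens (proj₂ t)) ⊗ (proj₁ t′ · tens (proj₂ t′)))
        ⊕ ((proj₁ t · tens (proj₂ t)) ⊗ combination ts′)
        ≈⟨ ⊕-cong (term-⊗ (proj₁ t) (proj₂ t) (proj₁ t′) (proj₂ t′)) (single-⊗ t ts′) ⟩
      combination (map (t ⋆ₜ_) (t′ ∷ ts′)) ∎

  invariant-⋆ᶠ : ∀ {F G} → Invariant F → Invariant G → Invariant (F ⋆ᶠ G)
  invariant-⋆ᶠ F-inv G-inv a = Local.⋆-invariant a (F-inv a) (G-inv a)

  all-invariant-⋆ : ∀ ts ts′ → All (Invariant ∘ proj₂) ts → All (Invariant ∘ proj₂) ts′ →
                    All (Invariant ∘ proj₂) (cartesianProductWith _⋆ₜ_ ts ts′)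
  all-invariant-⋆ []       ts′ []             _     = []
  all-invariant-⋆ (t ∷ ts) ts′ (t-inv ∷ ts-inv) ts′-inv =
    ++⁺ (map⁺ (single ts′ ts′-inv)) (all-invariant-⋆ ts ts′ ts-inv ts′-inv)
    where
    single : ∀ ts′ → All (Invariant ∘ proj₂) ts′ → All (Invariant ∘ proj₂ ∘ (t ⋆ₜ_)) ts′
    single []         []                = []
    single (t′ ∷ ts′) (t′-inv ∷ ts′-inv) = invariant-⋆ᶠ t-inv t′-inv ∷ single ts′ ts′-inv

  generator-span : ∀ {M} F → Invariant F → M ≈ₘ tens F → InvariantSpan M
  generator-span F F-inv M≈F =
    (1# , F) ∷ [] , F-inv ∷ [] , λ v w → trans (M≈F v w) (sym (trans (+-identityʳ _) (*-identityˡ _)))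

  span : ∀ {M} → InT x M → InvariantSpan M
  span (genA P) = generator-span _ (λ a → Local.adj-invariant a _) (A-tens P)
  span (genE P) = generator-span _ (λ a → Local.dual-invariant a _) (Estar-tens P)
  span unit     = generator-span _ (λ a → Local.adj-invariant a false) 𝟙-tens
  span (add TM TN) with span TM | span TN
  ... | ts , ts-inv , M≈ | ts′ , ts′-inv , N≈ =
    ts ++ ts′ , ++⁺ ts-inv ts′-inv , ≈ₘ.trans (⊕-cong M≈ N≈) (≈ₘ.sym (combination-++ ts ts′))
  span (smul k TM) with span TM
  ... | ts , ts-inv , M≈ =
    map (scale k) ts , map⁺ (scale-invariant ts ts-inv) , ≈ₘ.trans (·-cong k M≈) (≈ₘ.sym (combination-scale k ts))
    where
    scale-invariant : ∀ ts → All (Invariant ∘ proj₂) ts → All (Invariant ∘ proj₂ ∘ scale k) ts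
    scale-invariant []       []             = []
    scale-invariant (_ ∷ ts) (t-inv ∷ ts-inv) = t-inv ∷ scale-invariant ts ts-inv
  span (mul TM TN) with span TM | span TN
  ... | ts , ts-inv , M≈ | ts′ , ts′-inv , N≈ =
    _ , all-invariant-⋆ ts ts′ ts-inv ts′-inv , ≈ₘ.trans (⊗-cong M≈ N≈) (combination-⊗ ts ts′)
  span (resp M≈N TM) with span TM
  ... | ts , ts-inv , M≈ = ts , ts-inv , ≈ₘ.trans (≈ₘ.sym M≈N) M≈

  -- Central lifts

  e : Mat
  e = Estar x full

  eFamily : Family
  eFamily a = Local.dual a true

  e-tens : e ≈ₘ tens eFamily
  e-tens = ≈ₘ.trans (Estar-tens full)
                    (tens-cong λ a i k → reflexive (≡.cong (λ b → Local.dual a b i k) (⌊∈?full⌋ a)))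

  e-idem : (e ⊗ e) ≈ₘ e
  e-idem = begin
    e ⊗ e                          ≈⟨ ⊗-cong e-tens e-tens ⟩
    tens eFamily ⊗ tens eFamily    ≈⟨ tens-⊗ eFamily eFamily ⟩
    tens (eFamily ⋆ᶠ eFamily)      ≈⟨ tens-cong (λ a → Local.dual-idem a true) ⟩
    tens eFamily                   ≈⟨ e-tens ⟨
    e                              ∎
    where open ≈ₘ-Reasoning

  Choice : Set
  Choice = Pt n (λ _ → 3)

  awaySet offSet : Choice → Subset n
  awaySet C = tabulate (λ a → Local.away a (C a))
  offSet  C = tabulate (λ a → Local.offDiagonal a (C a))

  cellMatrix : Choice → Mat
  cellMatrix C = (Estar x (awaySet C) ⊗ A (offSet C)) ⊗ Estar x (awaySet C)

  cellMatrix-T : ∀ C → InT x (cellMatrix C)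
  cellMatrix-T C = mul (mul (genE _) (genA _)) (genE _)

  sandwich-tens : ∀ P Q P′ {β β′ β″ : (a : Fin n) → Bool} →
    (∀ a → ⌊ a ∈? P ⌋ ≡ β a) → (∀ a → ⌊ a ∈? Q ⌋ ≡ β′ a) → (∀ a → ⌊ a ∈? P′ ⌋ ≡ β″ a) →
    ((Estar x P ⊗ A Q) ⊗ Estar x P′) ≈ₘ tens (λ a → Local.sandwiched a (β a) (β″ a) (Local.adj a (β′ a)))
  sandwich-tens P Q P′ {β} {β′} {β″} P≡ Q≡ P′≡ = begin
    (Estar x P ⊗ A Q) ⊗ Estar x P′  ≈⟨ ⊗-cong (⊗-cong (Estar-tens P) (A-tens Q)) (Estar-tens P′) ⟩
    (tens D ⊗ tens Adj) ⊗ tens D′   ≈⟨ ⊗-cong (tens-⊗ D Adj) ≈ₘ.refl ⟩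
    tens (D ⋆ᶠ Adj) ⊗ tens D′       ≈⟨ tens-⊗ (D ⋆ᶠ Adj) D′ ⟩
    tens (D ⋆ᶠ Adj ⋆ᶠ D′)
      ≈⟨ tens-cong (λ a i k → trans (Local.sandwich a _ _ (Adj a) i k) (reflexive (bits a i k))) ⟩
    tens (λ a → Local.sandwiched a (β a) (β″ a) (Local.adj a (β′ a))) ∎
    where
    open ≈ₘ-Reasoning
    D Adj D′ : Family
    D a   = Local.dual a ⌊ a ∈? P ⌋
    Adj a = Local.adj a ⌊ a ∈? Q ⌋
    D′ a  = Local.dual a ⌊ a ∈? P′ ⌋
    bits : ∀ a i k → Local.sandwiched a ⌊ a ∈? P ⌋ ⌊ a ∈? P′ ⌋ (Adj a) i k
                   ≡ Local.sandwiched a (β a) (β″ a) (Local.adj a (β′ a)) i k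
    bits a i k rewrite P≡ a | Q≡ a | P′≡ a = ≡.refl

  cellMatrix-tens : ∀ C → cellMatrix C ≈ₘ tens (λ a → Local.cell a (C a))
  cellMatrix-tens C =
    ≈ₘ.trans (sandwich-tens (awaySet C) (offSet C) (awaySet C) away∈ (⌊∈?tabulate⌋ _) away∈)
             (tens-cong λ a → Local.sandwiched-cell a (C a))
    where
    away∈ : ∀ a → ⌊ a ∈? awaySet C ⌋ ≡ Local.away a (C a)
    away∈ = ⌊∈?tabulate⌋ _

  𝟘-T : InT x 𝟘
  𝟘-T = resp (λ v w → zeroˡ _) (smul 0# unit)

  combination-value : ∀ ts v w → combination ts v w ≈ sumL ts (λ t → proj₁ t * tens (proj₂ t) v w)
  combination-value []       v w = refl
  combination-value (t ∷ ts) v w = +-congˡ (combination-value ts v w)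

  liftFamily : Family → Family
  liftFamily F a = Local.lift a (F a)

  cellTerm : Family → Choice → Term
  cellTerm F C = prod (λ a → Local.coeff a (F a) (C a)) , (λ a → Local.cell a (C a))

  cellTerms-T : ∀ F Cs → InT x (combination (map (cellTerm F) Cs))
  cellTerms-T F []       = 𝟘-T
  cellTerms-T F (C ∷ Cs) = add (smul _ (resp (cellMatrix-tens C) (cellMatrix-T C))) (cellTerms-T F Cs)

  tens-lift : ∀ F → tens (liftFamily F) ≈ₘ combination (map (cellTerm F) (allPts n (λ _ → 3)))
  tens-lift F v w = begin
    prod (λ a → ∑[ o < 3 ] (Local.coeff a (F a) o * Local.cell a o (v a) (w a)))
      ≈⟨ sumPts-prod n (λ _ → 3) (λ a o → Local.coeff a (F a) o * Local.cell a o (v a) (w a)) ⟨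
    sumPts n (λ _ → 3) (λ C → prod (λ a → Local.coeff a (F a) (C a) * Local.cell a (C a) (v a) (w a)))
      ≈⟨ sumL-cong (allPts n (λ _ → 3)) (λ C → prod-distrib-* {n} _ _) ⟩
    sumPts n (λ _ → 3) (λ C → proj₁ (cellTerm F C) * tens (proj₂ (cellTerm F C)) v w)
      ≡⟨ sumL-map (cellTerm F) (allPts n (λ _ → 3)) _ ⟨
    sumL (map (cellTerm F) (allPts n (λ _ → 3))) (λ t → proj₁ t * tens (proj₂ t) v w)
      ≈⟨ combination-value (map (cellTerm F) (allPts n (λ _ → 3))) v w ⟨
    combination (map (cellTerm F) (allPts n (λ _ → 3))) v w ∎
    where open ≈-Reasoning

  lift-T : ∀ F → InT x (tens (liftFamily F))
  lift-T F = resp (≈ₘ.sym (tens-lift F)) (cellTerms-T F (allPts n (λ _ → 3)))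

  Central : Mat → Set (c ⊔ ℓ)
  Central M = ∀ N → InT x N → (M ⊗ N) ≈ₘ (N ⊗ M)

  central-by-generators : ∀ {M} → Ext M → (∀ P → (M ⊗ A P) ≈ₘ (A P ⊗ M)) →
                          (∀ P → (M ⊗ Estar x P) ≈ₘ (Estar x P ⊗ M)) → Central M
  central-by-generators {M} M-ext comm-A comm-E = go
    where
    open ≈ₘ-Reasoning
    go : Central M
    go _ (genA P) = comm-A P
    go _ (genE P) = comm-E P
    go _ unit     = ≈ₘ.trans (⊗-𝟙 M-ext) (≈ₘ.sym (𝟙-⊗ M-ext))
    go _ (add {N} {N′} TN TN′) = begin
      M ⊗ (N ⊕ N′)          ≈⟨ ⊗-distribˡ M N N′ ⟩
      (M ⊗ N) ⊕ (M ⊗ N′)    ≈⟨ ⊕-cong (go N TN) (go N′ TN′) ⟩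
      (N ⊗ M) ⊕ (N′ ⊗ M)    ≈⟨ ⊗-distribʳ M N N′ ⟨
      (N ⊕ N′) ⊗ M          ∎
    go _ (smul k {N} TN) = begin
      M ⊗ (k · N)           ≈⟨ ⊗-· k M N ⟩
      k · (M ⊗ N)           ≈⟨ ·-cong k (go N TN) ⟩
      k · (N ⊗ M)           ≈⟨ ·-⊗ k N M ⟨
      (k · N) ⊗ M           ∎
    go _ (mul {N} {N′} TN TN′) = begin
      M ⊗ (N ⊗ N′)          ≈⟨ ⊗-assoc M N N′ ⟨
      (M ⊗ N) ⊗ N′          ≈⟨ ⊗-cong (go N TN) ≈ₘ.refl ⟩
      (N ⊗ M) ⊗ N′          ≈⟨ ⊗-assoc N M N′ ⟩
      N ⊗ (M ⊗ N′)          ≈⟨ ⊗-cong ≈ₘ.refl (go N′ TN′) ⟩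
      N ⊗ (N′ ⊗ M)          ≈⟨ ⊗-assoc N N′ M ⟨
      (N ⊗ N′) ⊗ M          ∎
    go _ (resp {N} {N′} N≈N′ TN) = begin
      M ⊗ N′                ≈⟨ ⊗-cong ≈ₘ.refl (≈ₘ.sym N≈N′) ⟩
      M ⊗ N                 ≈⟨ go N TN ⟩
      N ⊗ M                 ≈⟨ ⊗-cong N≈N′ ≈ₘ.refl ⟩
      N′ ⊗ M                ∎

  commutes-via-tens : ∀ {F G N} → N ≈ₘ tens G → (∀ a i k → (F ⋆ᶠ G) a i k ≈ (G ⋆ᶠ F) a i k) →
                      (tens F ⊗ N) ≈ₘ (N ⊗ tens F)
  commutes-via-tens {F} {G} {N} N≈G local = begin
    tens F ⊗ N         ≈⟨ ⊗-cong ≈ₘ.refl N≈G ⟩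
    tens F ⊗ tens G    ≈⟨ tens-⊗ F G ⟩
    tens (F ⋆ᶠ G)      ≈⟨ tens-cong local ⟩
    tens (G ⋆ᶠ F)      ≈⟨ tens-⊗ G F ⟨
    tens G ⊗ tens F    ≈⟨ ⊗-cong (≈ₘ.sym N≈G) ≈ₘ.refl ⟩
    N ⊗ tens F         ∎
    where open ≈ₘ-Reasoning

  lift-central : ∀ F → Central (tens (liftFamily F))
  lift-central F = central-by-generators (ext-tens (liftFamily F))
    (λ P → commutes-via-tens (A-tens P) (λ a → Local.lift-commutes-adj a {F a} ⌊ a ∈? P ⌋))
    (λ P → commutes-via-tens (Estar-tens P) (λ a → Local.lift-commutes-dual a {F a} ⌊ a ∈? P ⌋))

  lift-corner : ∀ F → Invariant F → (tens (liftFamily F) ⊗ e) ≈ₘ ((e ⊗ tens F) ⊗ e)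
  lift-corner F F-inv = begin
    tens (liftFamily F) ⊗ e                   ≈⟨ ⊗-cong ≈ₘ.refl e-tens ⟩
    tens (liftFamily F) ⊗ tens eFamily        ≈⟨ tens-⊗ (liftFamily F) eFamily ⟩
    tens (liftFamily F ⋆ᶠ eFamily)            ≈⟨ tens-cong (λ a → Local.lift-corner a (F-inv a)) ⟩
    tens (eFamily ⋆ᶠ F ⋆ᶠ eFamily)            ≈⟨ tens-⊗ (eFamily ⋆ᶠ F) eFamily ⟨
    tens (eFamily ⋆ᶠ F) ⊗ tens eFamily        ≈⟨ ⊗-cong (tens-⊗ eFamily F) ≈ₘ.refl ⟨
    (tens eFamily ⊗ tens F) ⊗ tens eFamily    ≈⟨ ⊗-cong (⊗-cong e-tens ≈ₘ.refl) e-tens ⟨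
    (e ⊗ tens F) ⊗ e                          ∎
    where open ≈ₘ-Reasoning

  Liftable : Mat → Set (c ⊔ ℓ)
  Liftable M = Σ Mat λ W → InT x W × Central W × (W ⊗ e) ≈ₘ ((e ⊗ M) ⊗ e)

  liftable-resp : ∀ {M N} → M ≈ₘ N → Liftable M → Liftable N
  liftable-resp M≈N (W , TW , W-central , W-corner) =
    W , TW , W-central , ≈ₘ.trans W-corner (⊗-cong (⊗-cong ≈ₘ.refl M≈N) ≈ₘ.refl)

  liftable-𝟘 : Liftable 𝟘
  liftable-𝟘 = 𝟘 , 𝟘-T , (λ N _ → ≈ₘ.trans (⊗-zeroˡ N) (≈ₘ.sym (⊗-zeroʳ N))) ,
    ≈ₘ.trans (⊗-zeroˡ e) (≈ₘ.sym (≈ₘ.trans (⊗-cong (⊗-zeroʳ e) ≈ₘ.refl) (⊗-zeroˡ e)))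

  liftable-· : ∀ k {M} → Liftable M → Liftable (k · M)
  liftable-· k {M} (W , TW , W-central , W-corner) = k · W , smul k TW , central , corner
    where
    open ≈ₘ-Reasoning
    central : Central (k · W)
    central N TN = begin
      (k · W) ⊗ N    ≈⟨ ·-⊗ k W N ⟩
      k · (W ⊗ N)    ≈⟨ ·-cong k (W-central N TN) ⟩
      k · (N ⊗ W)    ≈⟨ ⊗-· k N W ⟨
      N ⊗ (k · W)    ∎
    corner : ((k · W) ⊗ e) ≈ₘ ((e ⊗ (k · M)) ⊗ e)
    corner = begin
      (k · W) ⊗ e              ≈⟨ ·-⊗ k W e ⟩
      k · (W ⊗ e)              ≈⟨ ·-cong k W-corner ⟩
      k · ((e ⊗ M) ⊗ e)        ≈⟨ ·-⊗ k (e ⊗ M) e ⟨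
      (k · (e ⊗ M)) ⊗ e        ≈⟨ ⊗-cong (⊗-· k e M) ≈ₘ.refl ⟨
      (e ⊗ (k · M)) ⊗ e        ∎

  liftable-⊕ : ∀ {M N} → Liftable M → Liftable N → Liftable (M ⊕ N)
  liftable-⊕ {M} {N} (W , TW , W-central , W-corner) (W′ , TW′ , W′-central , W′-corner) =
    W ⊕ W′ , add TW TW′ , central , corner
    where
    open ≈ₘ-Reasoning
    central : Central (W ⊕ W′)
    central K TK = begin
      (W ⊕ W′) ⊗ K           ≈⟨ ⊗-distribʳ K W W′ ⟩
      (W ⊗ K) ⊕ (W′ ⊗ K)     ≈⟨ ⊕-cong (W-central K TK) (W′-central K TK) ⟩
      (K ⊗ W) ⊕ (K ⊗ W′)     ≈⟨ ⊗-distribˡ K W W′ ⟨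
      K ⊗ (W ⊕ W′)           ∎
    corner : ((W ⊕ W′) ⊗ e) ≈ₘ ((e ⊗ (M ⊕ N)) ⊗ e)
    corner = begin
      (W ⊕ W′) ⊗ e                        ≈⟨ ⊗-distribʳ e W W′ ⟩
      (W ⊗ e) ⊕ (W′ ⊗ e)                  ≈⟨ ⊕-cong W-corner W′-corner ⟩
      ((e ⊗ M) ⊗ e) ⊕ ((e ⊗ N) ⊗ e)       ≈⟨ ⊗-distribʳ e (e ⊗ M) (e ⊗ N) ⟨
      ((e ⊗ M) ⊕ (e ⊗ N)) ⊗ e             ≈⟨ ⊗-cong (⊗-distribˡ e M N) ≈ₘ.refl ⟨
      (e ⊗ (M ⊕ N)) ⊗ e                   ∎

  liftable-tens : ∀ F → Invariant F → Liftable (tens F)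
  liftable-tens F F-inv = tens (liftFamily F) , lift-T F , lift-central F , lift-corner F F-inv

  liftable-combination : ∀ ts → All (Invariant ∘ proj₂) ts → Liftable (combination ts)
  liftable-combination []             []               = liftable-𝟘
  liftable-combination ((k , F) ∷ ts) (F-inv ∷ ts-inv) =
    liftable-⊕ (liftable-· k (liftable-tens F F-inv)) (liftable-combination ts ts-inv)

  liftable : ∀ {M} → InT x M → Liftable M
  liftable TM with span TM
  ... | ts , ts-inv , M≈ts = liftable-resp (≈ₘ.sym M≈ts) (liftable-combination ts ts-inv)

  -- Reading entries through the corner

  ⊗-unit-row : ∀ M N {v t} → (∀ p → M v p ≈ 𝟙 t p) → Ext N → ∀ w → (M ⊗ N) v w ≈ N t w
  ⊗-unit-row M N {v} {t} row N-ext w =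
    trans (sumL-cong (allPts n u) (λ p → *-congʳ (row p))) (𝟙-⊗ N-ext t w)

  ⊗-unit-col : ∀ M N {v s} → (∀ q → M q v ≈ 𝟙 q s) → Ext N → ∀ w → (N ⊗ M) w v ≈ N w s
  ⊗-unit-col M N {v} {s} col N-ext w =
    trans (sumL-cong (allPts n u) (λ q → *-congˡ (col q))) (⊗-𝟙 N-ext w s)

  module Faithfulness (u≥2 : ∀ a → 2 ≤ u a) where

    ρ : Pt n u
    ρ a = proj₁ (awayFrom (u≥2 a) (x a))

    x≢ρ : ∀ a → x a ≢ ρ a
    x≢ρ a = proj₂ (awayFrom (u≥2 a) (x a))

    -- every coordinate of shift t differs from x, and t is recovered from it by one relation R_g
    shift : Pt n u → Pt n u
    shift t a = Local.shift a (x≢ρ a) (t a)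

    nearBits farBits : Pt n u → Subset n
    nearBits t = tabulate (λ a → ⌊ x a ≟ᶠ t a ⌋)
    farBits  t = tabulate (λ a → not ⌊ x a ≟ᶠ t a ⌋)

    rowSelector colSelector : Pt n u → Mat
    rowSelector t = (e ⊗ A (nearBits t)) ⊗ Estar x (farBits t)
    colSelector s = (Estar x (farBits s) ⊗ A (nearBits s)) ⊗ e

    near∈ : ∀ t a → ⌊ a ∈? nearBits t ⌋ ≡ ⌊ x a ≟ᶠ t a ⌋
    near∈ t = ⌊∈?tabulate⌋ _

    far∈ : ∀ t a → ⌊ a ∈? farBits t ⌋ ≡ not ⌊ x a ≟ᶠ t a ⌋
    far∈ t = ⌊∈?tabulate⌋ _

    𝟙-prod : ∀ t p → prod (λ a → ind ⌊ t a ≟ᶠ p a ⌋) ≈ 𝟙 t p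
    𝟙-prod t p = sym (ind-all? _)

    rowSelector-row : ∀ t p → rowSelector t (shift t) p ≈ 𝟙 t p
    rowSelector-row t p =
      trans (sandwich-tens full (nearBits t) (farBits t) ⌊∈?full⌋ (near∈ t) (far∈ t) (shift t) p)
            (trans (prod-cong λ a → Local.selector-row a (x≢ρ a) (t a) (p a)) (𝟙-prod t p))

    colSelector-col : ∀ s q → colSelector s q (shift s) ≈ 𝟙 q s
    colSelector-col s q =
      trans (sandwich-tens (farBits s) (nearBits s) full (far∈ s) (near∈ s) ⌊∈?full⌋ q (shift s))
            (trans (prod-cong λ a → Local.selector-col a (x≢ρ a) (s a) (q a)) (𝟙-prod q s))

    shift-away : ∀ t a → x a ≢ shift t a
    shift-away t a = Local.shift-away a (x≢ρ a) (t a)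

    e-row : ∀ t p → e (shift t) p ≈ 𝟙 (shift t) p
    e-row t p = trans (e-tens (shift t) p)
      (trans (prod-cong λ a → Local.dual-true-away-row a (shift-away t a) (p a)) (𝟙-prod (shift t) p))

    e-col : ∀ s q → e q (shift s) ≈ 𝟙 q (shift s)
    e-col s q = trans (e-tens q (shift s))
      (trans (prod-cong λ a → Local.dual-true-away-col a (shift-away s a) (q a)) (𝟙-prod q (shift s)))

    entry-through-corner : ∀ {M} → Ext M → ∀ t s →
      M t s ≈ ((e ⊗ ((rowSelector t ⊗ M) ⊗ colSelector s)) ⊗ e) (shift t) (shift s)
    entry-through-corner {M} M-ext t s = begin
      M t s                                    ≈⟨ ⊗-unit-row Y M (rowSelector-row t) M-ext s ⟨
      (Y ⊗ M) (shift t) s                      ≈⟨ ⊗-unit-col Z (Y ⊗ M) (colSelector-col s) YM-ext (shift t) ⟨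
      ((Y ⊗ M) ⊗ Z) (shift t) (shift s)        ≈⟨ ⊗-unit-row e _ (e-row t) YMZ-ext (shift s) ⟨
      (e ⊗ ((Y ⊗ M) ⊗ Z)) (shift t) (shift s)  ≈⟨ ⊗-unit-col e _ (e-col s) eYMZ-ext (shift t) ⟨
      ((e ⊗ ((Y ⊗ M) ⊗ Z)) ⊗ e) (shift t) (shift s) ∎
      where
      open ≈-Reasoning
      Y Z : Mat
      Y = rowSelector t
      Z = colSelector s
      YM-ext : Ext (Y ⊗ M)
      YM-ext = ext-⊗ (ext-⊗ (ext-⊗ (ext-Estar full) (ext-A _)) (ext-Estar _)) M-ext
      YMZ-ext : Ext ((Y ⊗ M) ⊗ Z)
      YMZ-ext = ext-⊗ YM-ext (ext-⊗ (ext-⊗ (ext-Estar _) (ext-A _)) (ext-Estar full))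
      eYMZ-ext : Ext (e ⊗ ((Y ⊗ M) ⊗ Z))
      eYMZ-ext = ext-⊗ (ext-Estar full) YMZ-ext

    faithful : ∀ {M} → Ext M → (∀ Y Z → InT x Y → InT x Z → ((e ⊗ ((Y ⊗ M) ⊗ Z)) ⊗ e) ≈ₘ 𝟘) →
               M ≈ₘ 𝟘
    faithful M-ext vanishes t s = trans (entry-through-corner M-ext t s)
      (vanishes (rowSelector t) (colSelector s) (mul (mul (genE full) (genA _)) (genE _))
                (mul (mul (genE _) (genA _)) (genE full)) (shift t) (shift s))

  -- Semisimplicity

  open Radical extRing using (IsSemisimple; module Corner)

  InT′ : ExtMat → Set (c ⊔ ℓ)
  InT′ M = InT x (proj₁ M)

  toExt : ∀ {M} → InT x M → ExtMat
  toExt {M} TM = M , ext-T TM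

  open Corner InT′ resp unit add mul (smul (- 1#)) {e = e , ext-Estar full} (genE full) e-idem

  semisimple-ext⇔ : ∀ {S : Mat → Set (c ⊔ ℓ)} {S′ : ExtMat → Set (c ⊔ ℓ)} → (∀ {M} → S M → Ext M) →
                    (∀ {M} (M-ext : Ext M) → S M → S′ (M , M-ext)) → (∀ {M} → S′ M → S (proj₁ M)) →
                    ∀ f → Semisimple S (proj₁ f) ⇔ IsSemisimple S′ f
  semisimple-ext⇔ {S} {S′} ext-S to-S′ from-S′ f = mk⇔ to from
    where
    extend : ∀ M → S M → ExtMat
    extend M SM = M , ext-S SM
    to : Semisimple S (proj₁ f) → IsSemisimple S′ f
    to ss M S′M M-qr = ss (proj₁ M) (from-S′ S′M) qr
      where
      qr : ∀ b → S b → Σ Mat λ y → S y × ((y ⊗ (proj₁ f ⊖ (b ⊗ proj₁ M))) ≈ₘ proj₁ f)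
      qr b Sb with M-qr (extend b Sb) (to-S′ (ext-S Sb) Sb)
      ... | y , S′y , y-inv = proj₁ y , from-S′ S′y , y-inv
    from : IsSemisimple S′ f → Semisimple S (proj₁ f)
    from ss M SM M-qr = ss (extend M SM) (to-S′ (ext-S SM) SM) qr
      where
      qr : ∀ b → S′ b → Σ ExtMat λ y → S′ y × ((proj₁ y ⊗ (proj₁ f ⊖ (proj₁ b ⊗ M))) ≈ₘ proj₁ f)
      qr b S′b with M-qr (proj₁ b) (from-S′ S′b)
      ... | y , Sy , y-inv = extend y Sy , to-S′ (ext-S Sy) Sy , y-inv

  𝟙ₑ eₑ : ExtMat
  𝟙ₑ = 𝟙 , ext-𝟙
  eₑ = e , ext-Estar full

  T-semisimple⇔ : Semisimple (InT x) 𝟙 ⇔ IsSemisimple InT′ 𝟙ₑ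
  T-semisimple⇔ = semisimple-ext⇔ ext-T (λ _ TM → TM) id 𝟙ₑ

  EdTEd-semisimple⇔ : Semisimple (InEdTEd x) e ⇔ IsSemisimple InCorner eₑ
  EdTEd-semisimple⇔ = semisimple-ext⇔ ext-EdTEd (λ _ (M , TM , N≈) → toExt TM , TM , N≈)
                                     (λ ((M , _) , TM , N≈) → M , TM , N≈) eₑ
    where
    ext-EdTEd : ∀ {N} → InEdTEd x N → Ext N
    ext-EdTEd (M , TM , N≈) = ext-resp (≈ₘ.sym N≈) (ext-⊗ (ext-⊗ (ext-Estar full) (ext-T TM)) (ext-Estar full))

  Z-semisimple⇔ : Semisimple (InZ x) 𝟙 ⇔ IsSemisimple InCentre 𝟙ₑ
  Z-semisimple⇔ = semisimple-ext⇔ (ext-T ∘ proj₁) (λ _ (TM , M-comm) → TM , λ N TN → M-comm (proj₁ N) TN)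
                                  (λ (TM , M-comm) → TM , λ N TN → M-comm (toExt TN) TN) 𝟙ₑ

  module _ (u≥2 : ∀ a → 2 ≤ u a) where
    open Faithfulness u≥2

    faithful-ext : Faithful
    faithful-ext M vanishes = faithful (proj₂ M) λ Y Z TY TZ → vanishes (toExt TY) (toExt TZ) TY TZ

    liftable-ext : ∀ M → InT′ M → Σ ExtMat λ W → InCentre W × ((proj₁ W ⊗ e) ≈ₘ ((e ⊗ proj₁ M) ⊗ e))
    liftable-ext M TM with liftable TM
    ... | W , TW , W-central , W-corner = toExt TW , (TW , λ N TN → W-central (proj₁ N) TN) , W-corner

    T⇔corner : IsSemisimple InT′ 𝟙ₑ ⇔ IsSemisimple InCorner eₑ
    T⇔corner = mk⇔ semisimple⇒corner-semisimple (corner-semisimple⇒semisimple faithful-ext)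

    Z⇔corner : IsSemisimple InCentre 𝟙ₑ ⇔ IsSemisimple InCorner eₑ
    Z⇔corner = centre-semisimple⇔corner-semisimple faithful-ext liftable-ext

-- The argument works for every n.
corollary6p19 : {c ℓ : Level} (𝔽 : Field c ℓ) (n : ℕ) → 1 ≤ n →
    (u : Fin n → ℕ) → (∀ a → 2 ≤ u a) → (x : Pt n u) →
    let open Terwilliger 𝔽 n u in
    (Semisimple (InT x) 𝟙 ⇔ Semisimple (InEdTEd x) (Estar x full))
    × (Semisimple (InT x) 𝟙 ⇔ Semisimple (InZ x) 𝟙)
corollary6p19 𝔽 n _ u u≥2 x =
    ⇔-trans T-semisimple⇔ (⇔-trans (T⇔corner u≥2) (⇔-sym EdTEd-semisimple⇔))
  , ⇔-trans T-semisimple⇔ (⇔-trans (T⇔corner u≥2) (⇔-trans (⇔-sym (Z⇔corner u≥2)) (⇔-sym Z-semisimple⇔)))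
  where open FactorialTerwilliger 𝔽 n u x
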